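{- Let $\mathbb{X}$ be a linearly closed Cartesian differential category. Then: (1) If $f,g: A\times B\to C$ are linear in their second argument (so that $f+g$ and $0$ are as well), then $\lambda_\ell(f+g)=\lambda_\ell(f)+\lambda_\ell(g)$ and $\lambda_\ell(0)=0$. (2) If $f: A\times B\to C$ is linear in its second argument, then $\mathsf{D}[\lambda_\ell(f)] = \lambda_\ell\big(\mathsf{D}[f]\circ\langle\langle \pi_0\circ\pi_0,\pi_1\rangle,\langle \pi_1\circ\pi_0, 0\rangle\rangle\big)$, where $\mathsf{D}[f]\circ\langle\langle \pi_0\circ\pi_0,\pi_1\rangle,\langle \pi_1\circ\pi_0, 0\rangle\rangle: (A\times A)\times B\to C$ (in term logic: $\frac{\mathsf{d}\,\lambda_\ell y. f(x,y)}{\mathsf{d}x}(a)\cdot b=\lambda_\ell y.\frac{\mathsf{d}f(x,y)}{\mathsf{d}x}(a)\cdot b$). (3) There is a functor $\mathcal{L}:\mathsf{Lin}[\mathbb{X}]^{op}\times\mathsf{Lin}[\mathbb{X}]\to\mathsf{Lin}[\mathbb{X}]$ sending $(A,B)$ to $\mathcal{L}(A,B)$ and a pair of linear maps $f:A\to B$, $g:X\to Y$ to the linear map $\mathcal{L}(f,g):\mathcal{L}(B,X)\to\mathcal{L}(A,Y)$ defined as the linear curry of $g\circ\varepsilon_\ell\circ(1_{\mathcal{L}(B,X)}\times f):\mathcal{L}(B,X)\times A\to Y$. (4) There are natural isomorphisms (i) $\mathcal{L}(A,B\times C)\cong\mathcal{L}(A,B)\times\mathcal{L}(A,C)$, (ii)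 $\mathcal{L}(A,C)\times\mathcal{L}(B,C)\cong\mathcal{L}(A\times B,C)$, (iii) $\mathcal{L}(A,\top)\cong\top\cong\mathcal{L}(\top,A)$, and (iv) $\mathcal{L}(A,\mathcal{L}(B,C))\cong\mathcal{L}(B,\mathcal{L}(A,C))$.
   Context: A Cartesian left additive category is a category with chosen finite products (binary product $\times$, projections $\pi_0,\pi_1$, pairing $\langle-,-\rangle$, terminal object $\top$) in which every hom-set is a commutative monoid $(+,0)$, precomposition preserves the structure ($(f+g)\circ a=f\circ a+g\circ a$, $0\circ a=0$), and the projections are additive ($\pi_j\circ(a+b)=\pi_j\circ a+\pi_j\circ b$, $\pi_j\circ 0=0$). For maps $f,g$ write $f\times g=\langle f\circ\pi_0,g\circ\pi_1\rangle$. A Cartesian differential category is a Cartesian left additive category with an operator $\mathsf{D}$ sending $f:A\to B$ to $\mathsf{D}[f]:A\times A\to B$ such that: [CD.1] $\mathsf{D}[f+g]=\mathsf{D}[f]+\mathsf{D}[g]$, $\mathsf{D}[0]=0$; [CD.2] $\mathsf{D}[f]\circ\langle a,b+c\rangle=\mathsf{D}[f]\circ\langle a,b\rangle+\mathsf{D}[f]\circ\langle a,c\rangle$, $\mathsf{D}[f]\circ\langle a,0\rangle=0$; [CD.3] $\mathsf{D}[1_A]=\pi_1$, $\mathsf{D}[\pi_j]=\pi_j\circ\pi_1$; [CD.4] $\mathsf{D}[\langle f,g\rangle]=\langle\mathsf{D}[f],\mathsf{D}[g]\rangle$; [CD.5] $\mathsf{D}[g\circ f]=\mathsf{D}[g]\circ\langle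 f\circ\pi_0,\mathsf{D}[f]\rangle$; [CD.6] $\mathsf{D}[\mathsf{D}[f]]\circ\langle\langle a,b\rangle,\langle 0,c\rangle\rangle=\mathsf{D}[f]\circ\langle a,c\rangle$; [CD.7] $\mathsf{D}[\mathsf{D}[f]]\circ\langle\langle a,b\rangle,\langle c,0\rangle\rangle=\mathsf{D}[\mathsf{D}[f]]\circ\langle\langle a,c\rangle,\langle b,0\rangle\rangle$. A map $f:A\to B$ is linear if $\mathsf{D}[f]\circ\langle a,b\rangle=f\circ b$ for all $a,b$; $\mathsf{Lin}[\mathbb{X}]$ is the subcategory of all objects and linear maps. A map $f:A\times B\to C$ is linear in its second argument if $\mathsf{D}[f]\circ\langle\langle a,b\rangle,\langle 0,d\rangle\rangle=f\circ\langle a,d\rangle$ for all $a,b,d$, linear in its first argument if $\mathsf{D}[f]\circ\langle\langle a,b\rangle,\langle c,0\rangle\rangle=f\circ\langle c,b\rangle$ for all $a,b,c$, and bilinear if both. A linearly closed Cartesian differential category is a Cartesian differential category with, for each pair of objects $A,B$, an object $\mathcal{L}(A,B)$ and a bilinear map $\varepsilon_\ell:\mathcal{L}(A,B)\times A\to B$ such that for every $f:A\times B\to C$ linear in its second argument there is a unique $\lambda_\ell(f):A\to\mathcal{L}(B,C)$ (the linear curry) with $f=\varepsilon_\ell\circ(\lambda_\ell(f)\times 1_B)$. -}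

module Defs where

open import Level using (Level; _⊔_; suc)
open import Relation.Binary using (Rel; IsEquivalence)
open import Data.Product using (Σ; Σ-syntax; _,_) renaming (_×_ to _∧_)

record CDC (o ℓ e : Level) : Set (suc (o ⊔ ℓ ⊔ e)) where
  infixr 9 _∘_
  infixl 6 _+_
  infix  4 _≈_
  infixr 7 _×ₒ_
  infix  5 _⇒_
  field
    Obj   : Set o
    _⇒_   : Obj → Obj → Set ℓ
    _≈_   : ∀ {A B} → Rel (A ⇒ B) e
    ≈-equiv : ∀ {A B} → IsEquivalence (_≈_ {A} {B})
    id    : ∀ {A} → A ⇒ A
    _∘_   : ∀ {A B C} → B ⇒ C → A ⇒ B → A ⇒ C
    assoc : ∀ {A B C D} {f : A ⇒ B} {g : B ⇒ C} {h : C ⇒ D} →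
            (h ∘ g) ∘ f ≈ h ∘ (g ∘ f)
    identityˡ : ∀ {A B} {f : A ⇒ B} → id ∘ f ≈ f
    identityʳ : ∀ {A B} {f : A ⇒ B} → f ∘ id ≈ f
    ∘-resp-≈  : ∀ {A B C} {f h : B ⇒ C} {g i : A ⇒ B} →
                f ≈ h → g ≈ i → f ∘ g ≈ h ∘ i
    ⊤ₒ    : Obj
    !     : ∀ {A} → A ⇒ ⊤ₒ
    !-unique : ∀ {A} (h : A ⇒ ⊤ₒ) → h ≈ !
    _×ₒ_  : Obj → Obj → Obj
    π₀    : ∀ {A B} → A ×ₒ B ⇒ A
    π₁    : ∀ {A B} → A ×ₒ B ⇒ B
    ⟨_,_⟩ : ∀ {C A B} → C ⇒ A → C ⇒ B → C ⇒ A ×ₒ B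
    project₀ : ∀ {C A B} {f : C ⇒ A} {g : C ⇒ B} → π₀ ∘ ⟨ f , g ⟩ ≈ f
    project₁ : ∀ {C A B} {f : C ⇒ A} {g : C ⇒ B} → π₁ ∘ ⟨ f , g ⟩ ≈ g
    ⟨⟩-unique : ∀ {C A B} {f : C ⇒ A} {g : C ⇒ B} {h : C ⇒ A ×ₒ B} →
                π₀ ∘ h ≈ f → π₁ ∘ h ≈ g → h ≈ ⟨ f , g ⟩
    _+_   : ∀ {A B} → A ⇒ B → A ⇒ B → A ⇒ B
    0m    : ∀ {A B} → A ⇒ B
    +-resp-≈ : ∀ {A B} {f g h i : A ⇒ B} → f ≈ g → h ≈ i → f + h ≈ g + i
    +-assoc  : ∀ {A B} (f g h : A ⇒ B) → (f + g) + h ≈ f + (g + h)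
    +-comm   : ∀ {A B} (f g : A ⇒ B) → f + g ≈ g + f
    +-identityˡ : ∀ {A B} (f : A ⇒ B) → 0m + f ≈ f
    +-∘ : ∀ {A B C} (f g : B ⇒ C) (a : A ⇒ B) → (f + g) ∘ a ≈ f ∘ a + g ∘ a
    0-∘ : ∀ {A B C} (a : A ⇒ B) → 0m {B} {C} ∘ a ≈ 0m
    π₀-+ : ∀ {C A B} (a b : C ⇒ A ×ₒ B) → π₀ ∘ (a + b) ≈ π₀ ∘ a + π₀ ∘ b
    π₁-+ : ∀ {C A B} (a b : C ⇒ A ×ₒ B) → π₁ ∘ (a + b) ≈ π₁ ∘ a + π₁ ∘ b
    π₀-0 : ∀ {C A B} → π₀ ∘ 0m {C} {A ×ₒ B} ≈ 0m
    π₁-0 : ∀ {C A B} → π₁ ∘ 0m {C} {A ×ₒ B} ≈ 0m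
    D     : ∀ {A B} → A ⇒ B → A ×ₒ A ⇒ B
    D-resp-≈ : ∀ {A B} {f g : A ⇒ B} → f ≈ g → D f ≈ D g
    CD1-+ : ∀ {A B} (f g : A ⇒ B) → D (f + g) ≈ D f + D g
    CD1-0 : ∀ {A B} → D (0m {A} {B}) ≈ 0m
    CD2-+ : ∀ {Γ A B} (f : A ⇒ B) (a b c : Γ ⇒ A) →
            D f ∘ ⟨ a , b + c ⟩ ≈ D f ∘ ⟨ a , b ⟩ + D f ∘ ⟨ a , c ⟩
    CD2-0 : ∀ {Γ A B} (f : A ⇒ B) (a : Γ ⇒ A) → D f ∘ ⟨ a , 0m ⟩ ≈ 0m
    CD3-id : ∀ {A} → D (id {A}) ≈ π₁
    CD3-π₀ : ∀ {A B} → D (π₀ {A} {B}) ≈ π₀ ∘ π₁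
    CD3-π₁ : ∀ {A B} → D (π₁ {A} {B}) ≈ π₁ ∘ π₁
    CD4 : ∀ {C A B} (f : C ⇒ A) (g : C ⇒ B) → D ⟨ f , g ⟩ ≈ ⟨ D f , D g ⟩
    CD5 : ∀ {A B C} (f : A ⇒ B) (g : B ⇒ C) → D (g ∘ f) ≈ D g ∘ ⟨ f ∘ π₀ , D f ⟩
    CD6 : ∀ {Γ A B} (f : A ⇒ B) (a b c : Γ ⇒ A) →
          D (D f) ∘ ⟨ ⟨ a , b ⟩ , ⟨ 0m , c ⟩ ⟩ ≈ D f ∘ ⟨ a , c ⟩
    CD7 : ∀ {Γ A B} (f : A ⇒ B) (a b c : Γ ⇒ A) →
          D (D f) ∘ ⟨ ⟨ a , b ⟩ , ⟨ c , 0m ⟩ ⟩ ≈ D (D f) ∘ ⟨ ⟨ a , c ⟩ , ⟨ b , 0m ⟩ ⟩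

  infixr 8 _⁂_
  _⁂_ : ∀ {A B C E} → A ⇒ B → C ⇒ E → A ×ₒ C ⇒ B ×ₒ E
  f ⁂ g = ⟨ f ∘ π₀ , g ∘ π₁ ⟩

  -- linear maps (a, b generalized elements)
  Linear : ∀ {A B} → A ⇒ B → Set (o ⊔ ℓ ⊔ e)
  Linear {A} f = ∀ {Γ} (a b : Γ ⇒ A) → D f ∘ ⟨ a , b ⟩ ≈ f ∘ b

  Lin₂ : ∀ {A B C} → A ×ₒ B ⇒ C → Set (o ⊔ ℓ ⊔ e)
  Lin₂ {A} {B} f = ∀ {Γ} (a : Γ ⇒ A) (b d : Γ ⇒ B) →
    D f ∘ ⟨ ⟨ a , b ⟩ , ⟨ 0m , d ⟩ ⟩ ≈ f ∘ ⟨ a , d ⟩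

  Lin₁ : ∀ {A B C} → A ×ₒ B ⇒ C → Set (o ⊔ ℓ ⊔ e)
  Lin₁ {A} {B} f = ∀ {Γ} (a c : Γ ⇒ A) (b : Γ ⇒ B) →
    D f ∘ ⟨ ⟨ a , b ⟩ , ⟨ c , 0m ⟩ ⟩ ≈ f ∘ ⟨ c , b ⟩

  Bilinear : ∀ {A B C} → A ×ₒ B ⇒ C → Set (o ⊔ ℓ ⊔ e)
  Bilinear f = Lin₁ f ∧ Lin₂ f

  record LinIso (A B : Obj) : Set (o ⊔ ℓ ⊔ e) where
    field
      to      : A ⇒ B
      from    : B ⇒ A
      to-lin  : Linear to
      from-lin : Linear from
      isoˡ    : from ∘ to ≈ id
      isoʳ    : to ∘ from ≈ id

record LinearlyClosed {o ℓ e} (𝕏 : CDC o ℓ e) : Set (o ⊔ ℓ ⊔ e) where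
  open CDC 𝕏
  field
    𝓛   : Obj → Obj → Obj
    ε   : ∀ {A B} → 𝓛 A B ×ₒ A ⇒ B
    ε-bilinear : ∀ {A B} → Bilinear (ε {A} {B})
    λℓ  : ∀ {A B C} (f : A ×ₒ B ⇒ C) → Lin₂ f → A ⇒ 𝓛 B C
    λℓ-β : ∀ {A B C} (f : A ×ₒ B ⇒ C) (p : Lin₂ f) →
           f ≈ ε ∘ (λℓ f p ⁂ id)
    λℓ-unique : ∀ {A B C} (f : A ×ₒ B ⇒ C) (p : Lin₂ f) (h : A ⇒ 𝓛 B C) →
                f ≈ ε ∘ (h ⁂ id) → h ≈ λℓ f p

  Lbody : ∀ {A B X Y} → A ⇒ B → X ⇒ Y → 𝓛 B X ×ₒ A ⇒ Y
  Lbody f g = g ∘ (ε ∘ (id ⁂ f))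

  Lmap : ∀ {A B X Y} (f : A ⇒ B) (g : X ⇒ Y) → Lin₂ (Lbody f g) → 𝓛 B X ⇒ 𝓛 A Y
  Lmap f g p = λℓ (Lbody f g) p

module Claims {o ℓ e} (𝕏 : CDC o ℓ e) (LC : LinearlyClosed 𝕏) where
  open CDC 𝕏
  open LinearlyClosed LC
  open LinIso

  Claim1 : Set (o ⊔ ℓ ⊔ e)
  Claim1 =
    (∀ {A B C} (f g : A ×ₒ B ⇒ C) (pf : Lin₂ f) (pg : Lin₂ g) →
       Σ[ p ∈ Lin₂ (f + g) ] (λℓ (f + g) p ≈ λℓ f pf + λℓ g pg))
    ∧
    (∀ {A B C} → Σ[ p ∈ Lin₂ (0m {A ×ₒ B} {C}) ] (λℓ 0m p ≈ 0m))

  Claim2 : Set (o ⊔ ℓ ⊔ e)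
  Claim2 =
    ∀ {A B C} (f : A ×ₒ B ⇒ C) (pf : Lin₂ f) →
      Σ[ p ∈ Lin₂ (D f ∘ ⟨ ⟨ π₀ ∘ π₀ , π₁ ⟩ , ⟨ π₁ ∘ π₀ , 0m ⟩ ⟩) ]
        (D (λℓ f pf) ≈ λℓ (D f ∘ ⟨ ⟨ π₀ ∘ π₀ , π₁ ⟩ , ⟨ π₁ ∘ π₀ , 0m ⟩ ⟩) p)

  Claim3 : Set (o ⊔ ℓ ⊔ e)
  Claim3 =
    -- the curried map is defined for all linear f, g
    Σ (∀ {A B X Y} (f : A ⇒ B) (g : X ⇒ Y) → Linear f → Linear g → Lin₂ (Lbody f g)) λ _ →
    (∀ {A B X Y} (f : A ⇒ B) (g : X ⇒ Y) → Linear f → Linear g →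
       (p : Lin₂ (Lbody f g)) → Linear (Lmap f g p))
    ∧
    (∀ {A B X Y} (f₁ f₂ : A ⇒ B) (g₁ g₂ : X ⇒ Y) → Linear f₁ → Linear g₁ →
       f₁ ≈ f₂ → g₁ ≈ g₂ → (p₁ : Lin₂ (Lbody f₁ g₁)) (p₂ : Lin₂ (Lbody f₂ g₂)) →
       Lmap f₁ g₁ p₁ ≈ Lmap f₂ g₂ p₂)
    ∧
    (∀ {A X} (p : Lin₂ (Lbody (id {A}) (id {X}))) → Lmap id id p ≈ id)
    ∧
    (∀ {A' A B X Y Y'} (f : A ⇒ B) (f' : A' ⇒ A) (g : X ⇒ Y) (g' : Y ⇒ Y') →
       Linear f → Linear f' → Linear g → Linear g' →
       (p : Lin₂ (Lbody f g)) (q : Lin₂ (Lbody f' g')) (r : Lin₂ (Lbody (f ∘ f') (g' ∘ g))) →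
       Lmap (f ∘ f') (g' ∘ g) r ≈ Lmap f' g' q ∘ Lmap f g p)

  Claim4 : Set (o ⊔ ℓ ⊔ e)
  Claim4 =
    Σ (∀ A B C → LinIso (𝓛 A (B ×ₒ C)) (𝓛 A B ×ₒ 𝓛 A C)) (λ φ →
      ∀ {A A' B B' C C'} (a : A' ⇒ A) (b : B ⇒ B') (c : C ⇒ C') →
        Linear a → Linear b → Linear c →
        (p : Lin₂ (Lbody a b)) (q : Lin₂ (Lbody a c)) (r : Lin₂ (Lbody a (b ⁂ c))) →
        (Lmap a b p ⁂ Lmap a c q) ∘ to (φ A B C) ≈ to (φ A' B' C') ∘ Lmap a (b ⁂ c) r)
    ∧
    Σ (∀ A B C → LinIso (𝓛 A C ×ₒ 𝓛 B C) (𝓛 (A ×ₒ B) C)) (λ ψ →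
      ∀ {A A' B B' C C'} (a : A' ⇒ A) (b : B' ⇒ B) (c : C ⇒ C') →
        Linear a → Linear b → Linear c →
        (p : Lin₂ (Lbody a c)) (q : Lin₂ (Lbody b c)) (r : Lin₂ (Lbody (a ⁂ b) c)) →
        Lmap (a ⁂ b) c r ∘ to (ψ A B C) ≈ to (ψ A' B' C') ∘ (Lmap a c p ⁂ Lmap b c q))
    ∧
    Σ (∀ A → LinIso (𝓛 A ⊤ₒ) ⊤ₒ) (λ τ →
      ∀ {A A'} (a : A' ⇒ A) → Linear a → (p : Lin₂ (Lbody a (id {⊤ₒ}))) →
        to (τ A') ∘ Lmap a id p ≈ to (τ A))
    ∧
    Σ (∀ A → LinIso ⊤ₒ (𝓛 ⊤ₒ A)) (λ κ →
      ∀ {A A'} (g : A ⇒ A') → Linear g → (p : Lin₂ (Lbody (id {⊤ₒ}) g)) →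
        Lmap id g p ∘ to (κ A) ≈ to (κ A'))
    ∧
    Σ (∀ A B C → LinIso (𝓛 A (𝓛 B C)) (𝓛 B (𝓛 A C))) (λ σ →
      ∀ {A A' B B' C C'} (a : A' ⇒ A) (b : B' ⇒ B) (c : C ⇒ C') →
        Linear a → Linear b → Linear c →
        (p : Lin₂ (Lbody a c)) (q : Lin₂ (Lbody b (Lmap a c p)))
        (r : Lin₂ (Lbody b c)) (s : Lin₂ (Lbody a (Lmap b c r))) →
        Lmap b (Lmap a c p) q ∘ to (σ A B C) ≈ to (σ A' B' C') ∘ Lmap a (Lmap b c r) s)

-- Everything is checked on generalized elements.  By uniqueness of the linear
-- curry, two maps h, h' into 𝓛(A,B) agree as soon as ε ∘ ⟨ h ∘ u , v ⟩ ≈ ε ∘ ⟨ h' ∘ u , v ⟩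
-- for all u, v, and evaluating λℓ f at (u, v) just gives f (u, v).  Since ε is
-- bilinear it obeys the Leibniz rule, so evaluating D (λℓ f) at ((a, c), b) gives
-- D f ((a, b), (c, 0)); this yields (2) and shows that λℓ f is linear whenever f is
-- also linear in its first argument, which is why all the maps of (3) and (4) are
-- linear.  The remaining claims are then identities between evaluations:
-- 𝓛(A, B × C) → 𝓛(A,B) × 𝓛(A,C) is postcomposition with the projections,
-- (s, t) ↦ (λ (a, b). s a + t b) is inverse to restriction along the injections
-- ⟨ id , 0 ⟩ and ⟨ 0 , id ⟩, 𝓛(A,⊤) and 𝓛(⊤,A) are subterminal, and (iv) swaps the
-- two arguments of a doubly curried map.

module Submission where

open import Level using (_⊔_)
open import Data.Product using (_×_; _,_; proj₁; proj₂)
open import Relation.Binary.Bundles using (Setoid)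
import Relation.Binary.Reasoning.Setoid as SetoidReasoning
open import Defs

module CDCProperties {o ℓ e} (𝕏 : CDC o ℓ e) where
  open CDC 𝕏

  variable
    A B C E Γ Δ : Obj

  hom : Obj → Obj → Setoid ℓ e
  hom A B = record { Carrier = A ⇒ B ; _≈_ = _≈_ ; isEquivalence = ≈-equiv }

  module ≈ {A B : Obj} = Setoid (hom A B)
  module HomReasoning {A B : Obj} = SetoidReasoning (hom A B)
  open HomReasoning public

  ∘-resp-≈ˡ : ∀ {f h : B ⇒ C} {g : A ⇒ B} → f ≈ h → f ∘ g ≈ h ∘ g
  ∘-resp-≈ˡ p = ∘-resp-≈ p ≈.refl

  ∘-resp-≈ʳ : ∀ {f : B ⇒ C} {g i : A ⇒ B} → g ≈ i → f ∘ g ≈ f ∘ i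
  ∘-resp-≈ʳ p = ∘-resp-≈ ≈.refl p

  +-identityʳ : ∀ (f : A ⇒ B) → f + 0m ≈ f
  +-identityʳ f = ≈.trans (+-comm f 0m) (+-identityˡ f)

  ⊤-≈ : ∀ (f g : Γ ⇒ ⊤ₒ) → f ≈ g
  ⊤-≈ f g = ≈.trans (!-unique f) (≈.sym (!-unique g))

  ⟨⟩-cong₂ : ∀ {f f' : C ⇒ A} {g g' : C ⇒ B} → f ≈ f' → g ≈ g' → ⟨ f , g ⟩ ≈ ⟨ f' , g' ⟩
  ⟨⟩-cong₂ p q = ⟨⟩-unique (≈.trans project₀ p) (≈.trans project₁ q)

  ⟨⟩∘ : ∀ {f : C ⇒ A} {g : C ⇒ B} {h : Γ ⇒ C} → ⟨ f , g ⟩ ∘ h ≈ ⟨ f ∘ h , g ∘ h ⟩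
  ⟨⟩∘ = ⟨⟩-unique (≈.trans (≈.sym assoc) (∘-resp-≈ˡ project₀))
                  (≈.trans (≈.sym assoc) (∘-resp-≈ˡ project₁))

  project₀-∘ : ∀ {f : C ⇒ A} {g : C ⇒ B} {h : Γ ⇒ C} → π₀ ∘ (⟨ f , g ⟩ ∘ h) ≈ f ∘ h
  project₀-∘ = ≈.trans (≈.sym assoc) (∘-resp-≈ˡ project₀)

  project₁-∘ : ∀ {f : C ⇒ A} {g : C ⇒ B} {h : Γ ⇒ C} → π₁ ∘ (⟨ f , g ⟩ ∘ h) ≈ g ∘ h
  project₁-∘ = ≈.trans (≈.sym assoc) (∘-resp-≈ˡ project₁)

  ∘⟨⟩∘ : ∀ {k : A ×ₒ B ⇒ E} {f : C ⇒ A} {g : C ⇒ B} {h : Γ ⇒ C} →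
         (k ∘ ⟨ f , g ⟩) ∘ h ≈ k ∘ ⟨ f ∘ h , g ∘ h ⟩
  ∘⟨⟩∘ = ≈.trans assoc (∘-resp-≈ʳ ⟨⟩∘)

  η : ∀ {h : C ⇒ A ×ₒ B} → ⟨ π₀ ∘ h , π₁ ∘ h ⟩ ≈ h
  η = ≈.sym (⟨⟩-unique ≈.refl ≈.refl)

  ×-ext : ∀ {f g : C ⇒ A ×ₒ B} → π₀ ∘ f ≈ π₀ ∘ g → π₁ ∘ f ≈ π₁ ∘ g → f ≈ g
  ×-ext p q = ≈.trans (⟨⟩-unique p q) η

  ∘⁂∘⟨⟩ : ∀ {k : B ×ₒ E ⇒ C} {f : A ⇒ B} {g : Δ ⇒ E} {a : Γ ⇒ A} {b : Γ ⇒ Δ} →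
          (k ∘ (f ⁂ g)) ∘ ⟨ a , b ⟩ ≈ k ∘ ⟨ f ∘ a , g ∘ b ⟩
  ∘⁂∘⟨⟩ = ≈.trans ∘⟨⟩∘ (∘-resp-≈ʳ (⟨⟩-cong₂ (≈.trans assoc (∘-resp-≈ʳ project₀))
                                            (≈.trans assoc (∘-resp-≈ʳ project₁))))

  π₀-⁂-∘ : ∀ {f : A ⇒ B} {g : C ⇒ E} {h : Γ ⇒ A ×ₒ C} → π₀ ∘ ((f ⁂ g) ∘ h) ≈ f ∘ (π₀ ∘ h)
  π₀-⁂-∘ = ≈.trans project₀-∘ assoc

  π₁-⁂-∘ : ∀ {f : A ⇒ B} {g : C ⇒ E} {h : Γ ⇒ A ×ₒ C} → π₁ ∘ ((f ⁂ g) ∘ h) ≈ g ∘ (π₁ ∘ h)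
  π₁-⁂-∘ = ≈.trans project₁-∘ assoc

  ⟨⟩+⟨⟩ : ∀ {a c : Γ ⇒ A} {b d : Γ ⇒ B} → ⟨ a , b ⟩ + ⟨ c , d ⟩ ≈ ⟨ a + c , b + d ⟩
  ⟨⟩+⟨⟩ = ⟨⟩-unique (≈.trans (π₀-+ _ _) (+-resp-≈ project₀ project₀))
                    (≈.trans (π₁-+ _ _) (+-resp-≈ project₁ project₁))

  ⟨0,0⟩ : ⟨ 0m , 0m ⟩ ≈ 0m {Γ} {A ×ₒ B}
  ⟨0,0⟩ = ≈.sym (⟨⟩-unique π₀-0 π₁-0)

  chain-rule : ∀ (f : A ⇒ B) (g : B ⇒ C) {P Q : Γ ⇒ A} →
               D (g ∘ f) ∘ ⟨ P , Q ⟩ ≈ D g ∘ ⟨ f ∘ P , D f ∘ ⟨ P , Q ⟩ ⟩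
  chain-rule f g = ≈.trans (∘-resp-≈ˡ (CD5 f g))
    (≈.trans ∘⟨⟩∘ (∘-resp-≈ʳ (⟨⟩-cong₂ (≈.trans assoc (∘-resp-≈ʳ project₀)) ≈.refl)))

  D-π₀-pt : ∀ {P Q : Γ ⇒ A ×ₒ B} → D π₀ ∘ ⟨ P , Q ⟩ ≈ π₀ ∘ Q
  D-π₀-pt = ≈.trans (∘-resp-≈ˡ CD3-π₀) (≈.trans assoc (∘-resp-≈ʳ project₁))

  D-π₁-pt : ∀ {P Q : Γ ⇒ A ×ₒ B} → D π₁ ∘ ⟨ P , Q ⟩ ≈ π₁ ∘ Q
  D-π₁-pt = ≈.trans (∘-resp-≈ˡ CD3-π₁) (≈.trans assoc (∘-resp-≈ʳ project₁))

  D-∘π₀ : ∀ {f : A ⇒ C} {a c : Γ ⇒ A} {b d : Γ ⇒ B} →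
          D (f ∘ π₀) ∘ ⟨ ⟨ a , b ⟩ , ⟨ c , d ⟩ ⟩ ≈ D f ∘ ⟨ a , c ⟩
  D-∘π₀ {f = f} = ≈.trans (chain-rule π₀ f)
    (∘-resp-≈ʳ (⟨⟩-cong₂ project₀ (≈.trans D-π₀-pt project₀)))

  D-∘π₁ : ∀ {f : B ⇒ C} {a c : Γ ⇒ A} {b d : Γ ⇒ B} →
          D (f ∘ π₁) ∘ ⟨ ⟨ a , b ⟩ , ⟨ c , d ⟩ ⟩ ≈ D f ∘ ⟨ b , d ⟩
  D-∘π₁ {f = f} = ≈.trans (chain-rule π₁ f)
    (∘-resp-≈ʳ (⟨⟩-cong₂ project₁ (≈.trans D-π₁-pt project₁)))

  -- Linear, Lin₁ and Lin₂ all assert equations  D f ∘ Z ≈ f ∘ R  at suitable Z, R,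
  -- so their closure properties are proved once for that shape.
  D-0-≈ : ∀ {Z : Γ ⇒ A ×ₒ A} {R : Γ ⇒ A} → D (0m {A} {B}) ∘ Z ≈ 0m ∘ R
  D-0-≈ {Z = Z} {R} = ≈.trans (∘-resp-≈ˡ CD1-0) (≈.trans (0-∘ Z) (≈.sym (0-∘ R)))

  D-+-≈ : ∀ {f g : A ⇒ B} {Z : Γ ⇒ A ×ₒ A} {R : Γ ⇒ A} →
          D f ∘ Z ≈ f ∘ R → D g ∘ Z ≈ g ∘ R → D (f + g) ∘ Z ≈ (f + g) ∘ R
  D-+-≈ {f = f} {g} {Z} {R} p q = begin
    D (f + g) ∘ Z        ≈⟨ ∘-resp-≈ˡ (CD1-+ f g) ⟩
    (D f + D g) ∘ Z      ≈⟨ +-∘ _ _ _ ⟩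
    D f ∘ Z + D g ∘ Z    ≈⟨ +-resp-≈ p q ⟩
    f ∘ R + g ∘ R        ≈⟨ +-∘ _ _ _ ⟨
    (f + g) ∘ R          ∎

  D-pair-≈ : ∀ {f : A ⇒ B} {g : A ⇒ C} {Z : Γ ⇒ A ×ₒ A} {R : Γ ⇒ A} →
             D f ∘ Z ≈ f ∘ R → D g ∘ Z ≈ g ∘ R → D ⟨ f , g ⟩ ∘ Z ≈ ⟨ f , g ⟩ ∘ R
  D-pair-≈ {f = f} {g} p q = begin
    D ⟨ f , g ⟩ ∘ _      ≈⟨ ∘-resp-≈ˡ (CD4 f g) ⟩
    ⟨ D f , D g ⟩ ∘ _    ≈⟨ ⟨⟩∘ ⟩
    ⟨ D f ∘ _ , D g ∘ _ ⟩ ≈⟨ ⟨⟩-cong₂ p q ⟩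
    ⟨ f ∘ _ , g ∘ _ ⟩    ≈⟨ ⟨⟩∘ ⟨
    ⟨ f , g ⟩ ∘ _        ∎

  D-linear∘-≈ : ∀ {f : A ⇒ B} {g : B ⇒ C} {P Q R : Γ ⇒ A} → Linear g →
                D f ∘ ⟨ P , Q ⟩ ≈ f ∘ R → D (g ∘ f) ∘ ⟨ P , Q ⟩ ≈ (g ∘ f) ∘ R
  D-linear∘-≈ {f = f} {g} lg p =
    ≈.trans (chain-rule f g) (≈.trans (lg _ _) (≈.trans (∘-resp-≈ʳ p) (≈.sym assoc)))

  Linear-id : Linear (id {A})
  Linear-id a b = ≈.trans (∘-resp-≈ˡ CD3-id) (≈.trans project₁ (≈.sym identityˡ))

  Linear-π₀ : Linear (π₀ {A} {B})
  Linear-π₀ a b = D-π₀-pt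

  Linear-π₁ : Linear (π₁ {A} {B})
  Linear-π₁ a b = D-π₁-pt

  Linear-0 : Linear (0m {A} {B})
  Linear-0 a b = D-0-≈

  Linear-∘ : ∀ {f : A ⇒ B} {g : B ⇒ C} → Linear f → Linear g → Linear (g ∘ f)
  Linear-∘ lf lg a b = D-linear∘-≈ lg (lf a b)

  Linear-pair : ∀ {f : A ⇒ B} {g : A ⇒ C} → Linear f → Linear g → Linear ⟨ f , g ⟩
  Linear-pair lf lg a b = D-pair-≈ (lf a b) (lg a b)

  Linear-+ : ∀ {f : A ⇒ B} → Linear f → ∀ (x y : Γ ⇒ A) → f ∘ (x + y) ≈ f ∘ x + f ∘ y
  Linear-+ {f = f} lf x y = begin
    f ∘ (x + y)                             ≈⟨ lf 0m (x + y) ⟨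
    D f ∘ ⟨ 0m , x + y ⟩                    ≈⟨ CD2-+ f 0m x y ⟩
    D f ∘ ⟨ 0m , x ⟩ + D f ∘ ⟨ 0m , y ⟩     ≈⟨ +-resp-≈ (lf 0m x) (lf 0m y) ⟩
    f ∘ x + f ∘ y                           ∎

  Lin₂-0 : Lin₂ (0m {A ×ₒ B} {C})
  Lin₂-0 a b d = D-0-≈

  Lin₂-+ : ∀ {f g : A ×ₒ B ⇒ C} → Lin₂ f → Lin₂ g → Lin₂ (f + g)
  Lin₂-+ lf lg a b d = D-+-≈ (lf a b d) (lg a b d)

  Lin₁-+ : ∀ {f g : A ×ₒ B ⇒ C} → Lin₁ f → Lin₁ g → Lin₁ (f + g)
  Lin₁-+ lf lg a c b = D-+-≈ (lf a c b) (lg a c b)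

  Lin₂-pair : ∀ {f : A ×ₒ B ⇒ C} {g : A ×ₒ B ⇒ E} → Lin₂ f → Lin₂ g → Lin₂ ⟨ f , g ⟩
  Lin₂-pair lf lg a b d = D-pair-≈ (lf a b d) (lg a b d)

  Lin₁-pair : ∀ {f : A ×ₒ B ⇒ C} {g : A ×ₒ B ⇒ E} → Lin₁ f → Lin₁ g → Lin₁ ⟨ f , g ⟩
  Lin₁-pair lf lg a c b = D-pair-≈ (lf a c b) (lg a c b)

  Linear-∘-Lin₂ : ∀ {f : A ×ₒ B ⇒ C} {g : C ⇒ E} → Linear g → Lin₂ f → Lin₂ (g ∘ f)
  Linear-∘-Lin₂ lg lf a b d = D-linear∘-≈ lg (lf a b d)

  Linear-∘-Lin₁ : ∀ {f : A ×ₒ B ⇒ C} {g : C ⇒ E} → Linear g → Lin₁ f → Lin₁ (g ∘ f)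
  Linear-∘-Lin₁ lg lf a c b = D-linear∘-≈ lg (lf a c b)

  Lin₂-resp-≈ : ∀ {f g : A ×ₒ B ⇒ C} → f ≈ g → Lin₂ f → Lin₂ g
  Lin₂-resp-≈ f≈g lf a b d =
    ≈.trans (∘-resp-≈ˡ (D-resp-≈ (≈.sym f≈g))) (≈.trans (lf a b d) (∘-resp-≈ˡ f≈g))

  Lin₁-0ˡ : ∀ {f : A ×ₒ B ⇒ C} → Lin₁ f → ∀ (y : Γ ⇒ B) → f ∘ ⟨ 0m , y ⟩ ≈ 0m
  Lin₁-0ˡ {f = f} lf y = begin
    f ∘ ⟨ 0m , y ⟩                          ≈⟨ lf 0m 0m y ⟨
    D f ∘ ⟨ ⟨ 0m , y ⟩ , ⟨ 0m , 0m ⟩ ⟩      ≈⟨ ∘-resp-≈ʳ (⟨⟩-cong₂ ≈.refl ⟨0,0⟩) ⟩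
    D f ∘ ⟨ ⟨ 0m , y ⟩ , 0m ⟩               ≈⟨ CD2-0 f _ ⟩
    0m                                      ∎

  Lin₂-0ʳ : ∀ {f : A ×ₒ B ⇒ C} → Lin₂ f → ∀ (x : Γ ⇒ A) → f ∘ ⟨ x , 0m ⟩ ≈ 0m
  Lin₂-0ʳ {f = f} lf x = begin
    f ∘ ⟨ x , 0m ⟩                          ≈⟨ lf x 0m 0m ⟨
    D f ∘ ⟨ ⟨ x , 0m ⟩ , ⟨ 0m , 0m ⟩ ⟩      ≈⟨ ∘-resp-≈ʳ (⟨⟩-cong₂ ≈.refl ⟨0,0⟩) ⟩
    D f ∘ ⟨ ⟨ x , 0m ⟩ , 0m ⟩               ≈⟨ CD2-0 f _ ⟩
    0m                                      ∎

  Lin₁-+ˡ : ∀ {f : A ×ₒ B ⇒ C} → Lin₁ f → ∀ (x x' : Γ ⇒ A) (y : Γ ⇒ B) →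
            f ∘ ⟨ x + x' , y ⟩ ≈ f ∘ ⟨ x , y ⟩ + f ∘ ⟨ x' , y ⟩
  Lin₁-+ˡ {f = f} lf x x' y = begin
    f ∘ ⟨ x + x' , y ⟩                                      ≈⟨ lf x (x + x') y ⟨
    D f ∘ ⟨ ⟨ x , y ⟩ , ⟨ x + x' , 0m ⟩ ⟩                   ≈⟨ ∘-resp-≈ʳ (⟨⟩-cong₂ ≈.refl split) ⟩
    D f ∘ ⟨ ⟨ x , y ⟩ , ⟨ x , 0m ⟩ + ⟨ x' , 0m ⟩ ⟩          ≈⟨ CD2-+ f _ _ _ ⟩
    D f ∘ ⟨ ⟨ x , y ⟩ , ⟨ x , 0m ⟩ ⟩
      + D f ∘ ⟨ ⟨ x , y ⟩ , ⟨ x' , 0m ⟩ ⟩                   ≈⟨ +-resp-≈ (lf x x y) (lf x x' y) ⟩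
    f ∘ ⟨ x , y ⟩ + f ∘ ⟨ x' , y ⟩                          ∎
    where
    split : ⟨ x + x' , 0m ⟩ ≈ ⟨ x , 0m ⟩ + ⟨ x' , 0m ⟩
    split = ≈.sym (≈.trans ⟨⟩+⟨⟩ (⟨⟩-cong₂ ≈.refl (+-identityˡ 0m)))

  Lin₂-+ʳ : ∀ {f : A ×ₒ B ⇒ C} → Lin₂ f → ∀ (x : Γ ⇒ A) (y y' : Γ ⇒ B) →
            f ∘ ⟨ x , y + y' ⟩ ≈ f ∘ ⟨ x , y ⟩ + f ∘ ⟨ x , y' ⟩
  Lin₂-+ʳ {f = f} lf x y y' = begin
    f ∘ ⟨ x , y + y' ⟩                                      ≈⟨ lf x y (y + y') ⟨
    D f ∘ ⟨ ⟨ x , y ⟩ , ⟨ 0m , y + y' ⟩ ⟩                   ≈⟨ ∘-resp-≈ʳ (⟨⟩-cong₂ ≈.refl split) ⟩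
    D f ∘ ⟨ ⟨ x , y ⟩ , ⟨ 0m , y ⟩ + ⟨ 0m , y' ⟩ ⟩          ≈⟨ CD2-+ f _ _ _ ⟩
    D f ∘ ⟨ ⟨ x , y ⟩ , ⟨ 0m , y ⟩ ⟩
      + D f ∘ ⟨ ⟨ x , y ⟩ , ⟨ 0m , y' ⟩ ⟩                   ≈⟨ +-resp-≈ (lf x y y) (lf x y y') ⟩
    f ∘ ⟨ x , y ⟩ + f ∘ ⟨ x , y' ⟩                          ∎
    where
    split : ⟨ 0m , y + y' ⟩ ≈ ⟨ 0m , y ⟩ + ⟨ 0m , y' ⟩
    split = ≈.sym (≈.trans ⟨⟩+⟨⟩ (⟨⟩-cong₂ (+-identityˡ 0m) ≈.refl))

  Bilinear-D : ∀ {β : A ×ₒ B ⇒ C} → Bilinear β → ∀ {x x' : Γ ⇒ A} {y y' : Γ ⇒ B} →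
               D β ∘ ⟨ ⟨ x , y ⟩ , ⟨ x' , y' ⟩ ⟩ ≈ β ∘ ⟨ x' , y ⟩ + β ∘ ⟨ x , y' ⟩
  Bilinear-D {β = β} (l₁ , l₂) {x} {x'} {y} {y'} = begin
    D β ∘ ⟨ ⟨ x , y ⟩ , ⟨ x' , y' ⟩ ⟩                       ≈⟨ ∘-resp-≈ʳ (⟨⟩-cong₂ ≈.refl split) ⟩
    D β ∘ ⟨ ⟨ x , y ⟩ , ⟨ x' , 0m ⟩ + ⟨ 0m , y' ⟩ ⟩         ≈⟨ CD2-+ β _ _ _ ⟩
    D β ∘ ⟨ ⟨ x , y ⟩ , ⟨ x' , 0m ⟩ ⟩
      + D β ∘ ⟨ ⟨ x , y ⟩ , ⟨ 0m , y' ⟩ ⟩                   ≈⟨ +-resp-≈ (l₁ x x' y) (l₂ x y y') ⟩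
    β ∘ ⟨ x' , y ⟩ + β ∘ ⟨ x , y' ⟩                         ∎
    where
    split : ⟨ x' , y' ⟩ ≈ ⟨ x' , 0m ⟩ + ⟨ 0m , y' ⟩
    split = ≈.sym (≈.trans ⟨⟩+⟨⟩ (⟨⟩-cong₂ (+-identityʳ x') (+-identityˡ y')))

  Bilinear-Leibniz : ∀ {β : A ×ₒ B ⇒ C} → Bilinear β → ∀ {u : E ⇒ A} {v : E ⇒ B} {P Q : Γ ⇒ E} →
    D (β ∘ ⟨ u , v ⟩) ∘ ⟨ P , Q ⟩ ≈ β ∘ ⟨ D u ∘ ⟨ P , Q ⟩ , v ∘ P ⟩ + β ∘ ⟨ u ∘ P , D v ∘ ⟨ P , Q ⟩ ⟩
  Bilinear-Leibniz {β = β} bβ {u} {v} {P} {Q} = begin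
    D (β ∘ ⟨ u , v ⟩) ∘ ⟨ P , Q ⟩                                     ≈⟨ chain-rule ⟨ u , v ⟩ β ⟩
    D β ∘ ⟨ ⟨ u , v ⟩ ∘ P , D ⟨ u , v ⟩ ∘ ⟨ P , Q ⟩ ⟩                 ≈⟨ ∘-resp-≈ʳ (⟨⟩-cong₂ ⟨⟩∘ D-pair) ⟩
    D β ∘ ⟨ ⟨ u ∘ P , v ∘ P ⟩ , ⟨ D u ∘ ⟨ P , Q ⟩ , D v ∘ ⟨ P , Q ⟩ ⟩ ⟩ ≈⟨ Bilinear-D bβ ⟩
    β ∘ ⟨ D u ∘ ⟨ P , Q ⟩ , v ∘ P ⟩ + β ∘ ⟨ u ∘ P , D v ∘ ⟨ P , Q ⟩ ⟩ ∎
    where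
    D-pair : D ⟨ u , v ⟩ ∘ ⟨ P , Q ⟩ ≈ ⟨ D u ∘ ⟨ P , Q ⟩ , D v ∘ ⟨ P , Q ⟩ ⟩
    D-pair = ≈.trans (∘-resp-≈ˡ (CD4 u v)) ⟨⟩∘

  Bilinear-⁂-D : ∀ {β : A ×ₒ B ⇒ C} → Bilinear β →
    ∀ {h : E ⇒ A} {k : Δ ⇒ B} {a c : Γ ⇒ E} {b d : Γ ⇒ Δ} →
    D (β ∘ (h ⁂ k)) ∘ ⟨ ⟨ a , b ⟩ , ⟨ c , d ⟩ ⟩ ≈
      β ∘ ⟨ D h ∘ ⟨ a , c ⟩ , k ∘ b ⟩ + β ∘ ⟨ h ∘ a , D k ∘ ⟨ b , d ⟩ ⟩
  Bilinear-⁂-D bβ = ≈.trans (Bilinear-Leibniz bβ)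
    (+-resp-≈ (∘-resp-≈ʳ (⟨⟩-cong₂ D-∘π₀ (≈.trans assoc (∘-resp-≈ʳ project₁))))
              (∘-resp-≈ʳ (⟨⟩-cong₂ (≈.trans assoc (∘-resp-≈ʳ project₀)) D-∘π₁)))

  Bilinear-⁂-Lin₂ : ∀ {β : A ×ₒ B ⇒ C} {h : E ⇒ A} {k : Δ ⇒ B} →
                    Bilinear β → Linear k → Lin₂ (β ∘ (h ⁂ k))
  Bilinear-⁂-Lin₂ {β = β} {h} {k} bβ lk a b d = begin
    D (β ∘ (h ⁂ k)) ∘ ⟨ ⟨ a , b ⟩ , ⟨ 0m , d ⟩ ⟩                       ≈⟨ Bilinear-⁂-D bβ ⟩
    β ∘ ⟨ D h ∘ ⟨ a , 0m ⟩ , k ∘ b ⟩ + β ∘ ⟨ h ∘ a , D k ∘ ⟨ b , d ⟩ ⟩ ≈⟨ +-resp-≈ vanish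
                                                                                   (∘-resp-≈ʳ (⟨⟩-cong₂ ≈.refl (lk b d))) ⟩
    0m + β ∘ ⟨ h ∘ a , k ∘ d ⟩                                          ≈⟨ +-identityˡ _ ⟩
    β ∘ ⟨ h ∘ a , k ∘ d ⟩                                               ≈⟨ ∘⁂∘⟨⟩ ⟨
    (β ∘ (h ⁂ k)) ∘ ⟨ a , d ⟩                                           ∎
    where
    vanish : β ∘ ⟨ D h ∘ ⟨ a , 0m ⟩ , k ∘ b ⟩ ≈ 0m
    vanish = ≈.trans (∘-resp-≈ʳ (⟨⟩-cong₂ (CD2-0 h a) ≈.refl)) (Lin₁-0ˡ (proj₁ bβ) _)

  Bilinear-⁂-Lin₁ : ∀ {β : A ×ₒ B ⇒ C} {h : E ⇒ A} {k : Δ ⇒ B} →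
                    Bilinear β → Linear h → Lin₁ (β ∘ (h ⁂ k))
  Bilinear-⁂-Lin₁ {β = β} {h} {k} bβ lh a c b = begin
    D (β ∘ (h ⁂ k)) ∘ ⟨ ⟨ a , b ⟩ , ⟨ c , 0m ⟩ ⟩                       ≈⟨ Bilinear-⁂-D bβ ⟩
    β ∘ ⟨ D h ∘ ⟨ a , c ⟩ , k ∘ b ⟩ + β ∘ ⟨ h ∘ a , D k ∘ ⟨ b , 0m ⟩ ⟩ ≈⟨ +-resp-≈ (∘-resp-≈ʳ (⟨⟩-cong₂ (lh a c) ≈.refl))
                                                                                   vanish ⟩
    β ∘ ⟨ h ∘ c , k ∘ b ⟩ + 0m                                          ≈⟨ +-identityʳ _ ⟩
    β ∘ ⟨ h ∘ c , k ∘ b ⟩                                               ≈⟨ ∘⁂∘⟨⟩ ⟨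
    (β ∘ (h ⁂ k)) ∘ ⟨ c , b ⟩                                           ∎
    where
    vanish : β ∘ ⟨ h ∘ a , D k ∘ ⟨ b , 0m ⟩ ⟩ ≈ 0m
    vanish = ≈.trans (∘-resp-≈ʳ (⟨⟩-cong₂ ≈.refl (CD2-0 k b))) (Lin₂-0ʳ (proj₂ bβ) _)

module LinearlyClosedProperties {o ℓ e} {𝕏 : CDC o ℓ e} (LC : LinearlyClosed 𝕏) where
  open CDC 𝕏
  open LinearlyClosed LC
  open CDCProperties 𝕏

  ε-cong : ∀ {x x' : Γ ⇒ 𝓛 A B} {y y' : Γ ⇒ A} → x ≈ x' → y ≈ y' → ε ∘ ⟨ x , y ⟩ ≈ ε ∘ ⟨ x' , y' ⟩
  ε-cong p q = ∘-resp-≈ʳ (⟨⟩-cong₂ p q)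

  ε-0ˡ : ∀ {y : Γ ⇒ A} → ε ∘ ⟨ 0m , y ⟩ ≈ 0m {Γ} {B}
  ε-0ˡ = Lin₁-0ˡ (proj₁ ε-bilinear) _

  ε-0ʳ : ∀ {x : Γ ⇒ 𝓛 A B} → ε ∘ ⟨ x , 0m ⟩ ≈ 0m
  ε-0ʳ = Lin₂-0ʳ (proj₂ ε-bilinear) _

  λℓ-β-pt : ∀ {f : A ×ₒ B ⇒ C} (p : Lin₂ f) (u : Γ ⇒ A) (v : Γ ⇒ B) →
            ε ∘ ⟨ λℓ f p ∘ u , v ⟩ ≈ f ∘ ⟨ u , v ⟩
  λℓ-β-pt {f = f} p u v = begin
    ε ∘ ⟨ λℓ f p ∘ u , v ⟩          ≈⟨ ε-cong ≈.refl identityˡ ⟨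
    ε ∘ ⟨ λℓ f p ∘ u , id ∘ v ⟩     ≈⟨ ∘⁂∘⟨⟩ ⟨
    (ε ∘ (λℓ f p ⁂ id)) ∘ ⟨ u , v ⟩ ≈⟨ ∘-resp-≈ˡ (λℓ-β f p) ⟨
    f ∘ ⟨ u , v ⟩                   ∎

  𝓛-ext : ∀ {h h' : Γ ⇒ 𝓛 A B} →
          (∀ {Δ} (u : Δ ⇒ Γ) (v : Δ ⇒ A) → ε ∘ ⟨ h ∘ u , v ⟩ ≈ ε ∘ ⟨ h' ∘ u , v ⟩) → h ≈ h'
  𝓛-ext {h = h} {h'} pointwise =
    ≈.trans (λℓ-unique (ε ∘ (h ⁂ id)) lin h ≈.refl)
            (≈.sym (λℓ-unique (ε ∘ (h ⁂ id)) lin h' (pointwise π₀ (id ∘ π₁))))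
    where
    lin : Lin₂ (ε ∘ (h ⁂ id))
    lin = Bilinear-⁂-Lin₂ ε-bilinear Linear-id

  𝓛-ext₂ : ∀ {h h' : Γ ⇒ 𝓛 A (𝓛 B C)} →
           (∀ {Δ} (u : Δ ⇒ Γ) (a : Δ ⇒ A) (b : Δ ⇒ B) →
              ε ∘ ⟨ ε ∘ ⟨ h ∘ u , a ⟩ , b ⟩ ≈ ε ∘ ⟨ ε ∘ ⟨ h' ∘ u , a ⟩ , b ⟩) → h ≈ h'
  𝓛-ext₂ {h = h} {h'} pointwise = 𝓛-ext λ u a → 𝓛-ext λ u' b → begin
    ε ∘ ⟨ (ε ∘ ⟨ h ∘ u , a ⟩) ∘ u' , b ⟩        ≈⟨ ε-cong (regroup h) ≈.refl ⟩
    ε ∘ ⟨ ε ∘ ⟨ h ∘ (u ∘ u') , a ∘ u' ⟩ , b ⟩   ≈⟨ pointwise (u ∘ u') (a ∘ u') b ⟩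
    ε ∘ ⟨ ε ∘ ⟨ h' ∘ (u ∘ u') , a ∘ u' ⟩ , b ⟩  ≈⟨ ε-cong (regroup h') ≈.refl ⟨
    ε ∘ ⟨ (ε ∘ ⟨ h' ∘ u , a ⟩) ∘ u' , b ⟩       ∎
    where
    regroup : ∀ {Δ Δ'} (k : Γ ⇒ 𝓛 A (𝓛 B C)) {u : Δ ⇒ Γ} {a : Δ ⇒ A} {u' : Δ' ⇒ Δ} →
              (ε ∘ ⟨ k ∘ u , a ⟩) ∘ u' ≈ ε ∘ ⟨ k ∘ (u ∘ u') , a ∘ u' ⟩
    regroup k = ≈.trans ∘⟨⟩∘ (ε-cong assoc ≈.refl)

  D-λℓ-pt : ∀ {f : A ×ₒ B ⇒ C} (p : Lin₂ f) (a c : Γ ⇒ A) (b : Γ ⇒ B) →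
            ε ∘ ⟨ D (λℓ f p) ∘ ⟨ a , c ⟩ , b ⟩ ≈ D f ∘ ⟨ ⟨ a , b ⟩ , ⟨ c , 0m ⟩ ⟩
  D-λℓ-pt {f = f} p a c b = ≈.sym (begin
    D f ∘ ⟨ ⟨ a , b ⟩ , ⟨ c , 0m ⟩ ⟩                     ≈⟨ ∘-resp-≈ˡ (D-resp-≈ (λℓ-β f p)) ⟩
    D (ε ∘ (λℓ f p ⁂ id)) ∘ ⟨ ⟨ a , b ⟩ , ⟨ c , 0m ⟩ ⟩  ≈⟨ Bilinear-⁂-D ε-bilinear ⟩
    ε ∘ ⟨ D (λℓ f p) ∘ ⟨ a , c ⟩ , id ∘ b ⟩
      + ε ∘ ⟨ λℓ f p ∘ a , D id ∘ ⟨ b , 0m ⟩ ⟩          ≈⟨ +-resp-≈ (ε-cong ≈.refl identityˡ)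
                                                                    (≈.trans (ε-cong ≈.refl (CD2-0 id b)) ε-0ʳ) ⟩
    ε ∘ ⟨ D (λℓ f p) ∘ ⟨ a , c ⟩ , b ⟩ + 0m             ≈⟨ +-identityʳ _ ⟩
    ε ∘ ⟨ D (λℓ f p) ∘ ⟨ a , c ⟩ , b ⟩                  ∎)

  D-λℓ-≈ : ∀ {f : A ×ₒ B ⇒ C} (p : Lin₂ f) {P Q R : Γ ⇒ A} →
           (∀ {Δ} (u : Δ ⇒ Γ) (v : Δ ⇒ B) →
              D f ∘ ⟨ ⟨ P ∘ u , v ⟩ , ⟨ Q ∘ u , 0m ⟩ ⟩ ≈ f ∘ ⟨ R ∘ u , v ⟩) →
           D (λℓ f p) ∘ ⟨ P , Q ⟩ ≈ λℓ f p ∘ R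
  D-λℓ-≈ {f = f} p {P} {Q} {R} pointwise = 𝓛-ext λ u v → begin
    ε ∘ ⟨ (D (λℓ f p) ∘ ⟨ P , Q ⟩) ∘ u , v ⟩   ≈⟨ ε-cong ∘⟨⟩∘ ≈.refl ⟩
    ε ∘ ⟨ D (λℓ f p) ∘ ⟨ P ∘ u , Q ∘ u ⟩ , v ⟩ ≈⟨ D-λℓ-pt p _ _ v ⟩
    D f ∘ ⟨ ⟨ P ∘ u , v ⟩ , ⟨ Q ∘ u , 0m ⟩ ⟩   ≈⟨ pointwise u v ⟩
    f ∘ ⟨ R ∘ u , v ⟩                          ≈⟨ λℓ-β-pt p (R ∘ u) v ⟨
    ε ∘ ⟨ λℓ f p ∘ (R ∘ u) , v ⟩               ≈⟨ ε-cong assoc ≈.refl ⟨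
    ε ∘ ⟨ (λℓ f p ∘ R) ∘ u , v ⟩               ∎

  λℓ-Linear : ∀ {f : A ×ₒ B ⇒ C} (p : Lin₂ f) → Lin₁ f → Linear (λℓ f p)
  λℓ-Linear p l₁ a b = D-λℓ-≈ p λ u v → l₁ (a ∘ u) (b ∘ u) v

  λℓ-+ : ∀ {f g : A ×ₒ B ⇒ C} (pf : Lin₂ f) (pg : Lin₂ g) (p : Lin₂ (f + g)) →
         λℓ (f + g) p ≈ λℓ f pf + λℓ g pg
  λℓ-+ {f = f} {g} pf pg p = 𝓛-ext λ u v → begin
    ε ∘ ⟨ λℓ (f + g) p ∘ u , v ⟩                          ≈⟨ λℓ-β-pt p u v ⟩
    (f + g) ∘ ⟨ u , v ⟩                                   ≈⟨ +-∘ f g _ ⟩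
    f ∘ ⟨ u , v ⟩ + g ∘ ⟨ u , v ⟩                         ≈⟨ +-resp-≈ (λℓ-β-pt pf u v) (λℓ-β-pt pg u v) ⟨
    ε ∘ ⟨ λℓ f pf ∘ u , v ⟩ + ε ∘ ⟨ λℓ g pg ∘ u , v ⟩     ≈⟨ Lin₁-+ˡ (proj₁ ε-bilinear) _ _ v ⟨
    ε ∘ ⟨ λℓ f pf ∘ u + λℓ g pg ∘ u , v ⟩                 ≈⟨ ε-cong (+-∘ _ _ u) ≈.refl ⟨
    ε ∘ ⟨ (λℓ f pf + λℓ g pg) ∘ u , v ⟩                   ∎

  λℓ-0 : (p : Lin₂ (0m {A ×ₒ B} {C})) → λℓ 0m p ≈ 0m
  λℓ-0 p = 𝓛-ext λ u v → begin
    ε ∘ ⟨ λℓ 0m p ∘ u , v ⟩   ≈⟨ λℓ-β-pt p u v ⟩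
    0m ∘ ⟨ u , v ⟩            ≈⟨ 0-∘ _ ⟩
    0m                        ≈⟨ ε-0ˡ ⟨
    ε ∘ ⟨ 0m , v ⟩            ≈⟨ ε-cong (0-∘ u) ≈.refl ⟨
    ε ∘ ⟨ 0m ∘ u , v ⟩        ∎

  ∂₀ : A ×ₒ B ⇒ C → (A ×ₒ A) ×ₒ B ⇒ C
  ∂₀ f = D f ∘ ⟨ ⟨ π₀ ∘ π₀ , π₁ ⟩ , ⟨ π₁ ∘ π₀ , 0m ⟩ ⟩

  ∂₀-≈-ε : ∀ {f : A ×ₒ B ⇒ C} (p : Lin₂ f) → ∂₀ f ≈ ε ∘ (D (λℓ f p) ⁂ id)
  ∂₀-≈-ε {f = f} p = ≈.sym (begin
    ε ∘ ⟨ D (λℓ f p) ∘ π₀ , id ∘ π₁ ⟩                          ≈⟨ ε-cong (∘-resp-≈ʳ (≈.sym η)) identityˡ ⟩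
    ε ∘ ⟨ D (λℓ f p) ∘ ⟨ π₀ ∘ π₀ , π₁ ∘ π₀ ⟩ , π₁ ⟩            ≈⟨ D-λℓ-pt p _ _ _ ⟩
    D f ∘ ⟨ ⟨ π₀ ∘ π₀ , π₁ ⟩ , ⟨ π₁ ∘ π₀ , 0m ⟩ ⟩              ∎)

  ∂₀-Lin₂ : ∀ {f : A ×ₒ B ⇒ C} → Lin₂ f → Lin₂ (∂₀ f)
  ∂₀-Lin₂ p = Lin₂-resp-≈ (≈.sym (∂₀-≈-ε p)) (Bilinear-⁂-Lin₂ ε-bilinear Linear-id)

  D-λℓ : ∀ {f : A ×ₒ B ⇒ C} (p : Lin₂ f) (q : Lin₂ (∂₀ f)) → D (λℓ f p) ≈ λℓ (∂₀ f) q
  D-λℓ p q = λℓ-unique _ q _ (∂₀-≈-ε p)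

  Lbody-Lin₂ : ∀ {f : A ⇒ B} {g : C ⇒ E} → Linear f → Linear g → Lin₂ (Lbody f g)
  Lbody-Lin₂ lf lg = Linear-∘-Lin₂ lg (Bilinear-⁂-Lin₂ ε-bilinear lf)

  Lbody-Lin₁ : ∀ {f : A ⇒ B} {g : C ⇒ E} → Linear g → Lin₁ (Lbody f g)
  Lbody-Lin₁ lg = Linear-∘-Lin₁ lg (Bilinear-⁂-Lin₁ ε-bilinear Linear-id)

  Lmap-Linear : ∀ {f : A ⇒ B} {g : C ⇒ E} → Linear g → (p : Lin₂ (Lbody f g)) → Linear (Lmap f g p)
  Lmap-Linear lg p = λℓ-Linear p (Lbody-Lin₁ lg)

  Lmap-pt : ∀ {f : A ⇒ B} {g : C ⇒ E} (p : Lin₂ (Lbody f g)) (u : Γ ⇒ 𝓛 B C) (v : Γ ⇒ A) →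
            ε ∘ ⟨ Lmap f g p ∘ u , v ⟩ ≈ g ∘ (ε ∘ ⟨ u , f ∘ v ⟩)
  Lmap-pt {f = f} {g} p u v = begin
    ε ∘ ⟨ Lmap f g p ∘ u , v ⟩        ≈⟨ λℓ-β-pt p u v ⟩
    (g ∘ (ε ∘ (id ⁂ f))) ∘ ⟨ u , v ⟩  ≈⟨ assoc ⟩
    g ∘ ((ε ∘ (id ⁂ f)) ∘ ⟨ u , v ⟩)  ≈⟨ ∘-resp-≈ʳ (≈.trans ∘⁂∘⟨⟩ (ε-cong identityˡ ≈.refl)) ⟩
    g ∘ (ε ∘ ⟨ u , f ∘ v ⟩)           ∎

  Lmap-∘-pt : ∀ {A' A B X Y Y'} {f : A ⇒ B} {f' : A' ⇒ A} {g : X ⇒ Y} {g' : Y ⇒ Y'}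
              (p : Lin₂ (Lbody f g)) (q : Lin₂ (Lbody f' g')) (u : Γ ⇒ 𝓛 B X) (v : Γ ⇒ A') →
              ε ∘ ⟨ (Lmap f' g' q ∘ Lmap f g p) ∘ u , v ⟩ ≈ (g' ∘ g) ∘ (ε ∘ ⟨ u , (f ∘ f') ∘ v ⟩)
  Lmap-∘-pt {f = f} {f'} {g} {g'} p q u v = begin
    ε ∘ ⟨ (Lmap f' g' q ∘ Lmap f g p) ∘ u , v ⟩   ≈⟨ ε-cong assoc ≈.refl ⟩
    ε ∘ ⟨ Lmap f' g' q ∘ (Lmap f g p ∘ u) , v ⟩   ≈⟨ Lmap-pt q _ v ⟩
    g' ∘ (ε ∘ ⟨ Lmap f g p ∘ u , f' ∘ v ⟩)        ≈⟨ ∘-resp-≈ʳ (Lmap-pt p u _) ⟩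
    g' ∘ (g ∘ (ε ∘ ⟨ u , f ∘ (f' ∘ v) ⟩))         ≈⟨ assoc ⟨
    (g' ∘ g) ∘ (ε ∘ ⟨ u , f ∘ (f' ∘ v) ⟩)         ≈⟨ ∘-resp-≈ʳ (ε-cong ≈.refl assoc) ⟨
    (g' ∘ g) ∘ (ε ∘ ⟨ u , (f ∘ f') ∘ v ⟩)         ∎

  Lmap-cong : ∀ {f₁ f₂ : A ⇒ B} {g₁ g₂ : C ⇒ E} → f₁ ≈ f₂ → g₁ ≈ g₂ →
              (p₁ : Lin₂ (Lbody f₁ g₁)) (p₂ : Lin₂ (Lbody f₂ g₂)) → Lmap f₁ g₁ p₁ ≈ Lmap f₂ g₂ p₂
  Lmap-cong {f₁ = f₁} {f₂} {g₁} {g₂} f₁≈f₂ g₁≈g₂ p₁ p₂ = 𝓛-ext λ u v → begin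
    ε ∘ ⟨ Lmap f₁ g₁ p₁ ∘ u , v ⟩   ≈⟨ Lmap-pt p₁ u v ⟩
    g₁ ∘ (ε ∘ ⟨ u , f₁ ∘ v ⟩)       ≈⟨ ∘-resp-≈ g₁≈g₂ (ε-cong ≈.refl (∘-resp-≈ˡ f₁≈f₂)) ⟩
    g₂ ∘ (ε ∘ ⟨ u , f₂ ∘ v ⟩)       ≈⟨ Lmap-pt p₂ u v ⟨
    ε ∘ ⟨ Lmap f₂ g₂ p₂ ∘ u , v ⟩   ∎

  Lmap-id : (p : Lin₂ (Lbody (id {A}) (id {B}))) → Lmap id id p ≈ id
  Lmap-id p = 𝓛-ext λ u v → begin
    ε ∘ ⟨ Lmap id id p ∘ u , v ⟩   ≈⟨ Lmap-pt p u v ⟩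
    id ∘ (ε ∘ ⟨ u , id ∘ v ⟩)      ≈⟨ identityˡ ⟩
    ε ∘ ⟨ u , id ∘ v ⟩             ≈⟨ ε-cong (≈.sym identityˡ) identityˡ ⟩
    ε ∘ ⟨ id ∘ u , v ⟩             ∎

  Lmap-∘ : ∀ {A' A B X Y Y'} {f : A ⇒ B} {f' : A' ⇒ A} {g : X ⇒ Y} {g' : Y ⇒ Y'}
           (p : Lin₂ (Lbody f g)) (q : Lin₂ (Lbody f' g')) (r : Lin₂ (Lbody (f ∘ f') (g' ∘ g))) →
           Lmap (f ∘ f') (g' ∘ g) r ≈ Lmap f' g' q ∘ Lmap f g p
  Lmap-∘ p q r = 𝓛-ext λ u v → ≈.trans (Lmap-pt r u v) (≈.sym (Lmap-∘-pt p q u v))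

  Lmap-square : ∀ {A₁ A₂ A B X Y₁ Y₂ Y}
    {f₁ : A₁ ⇒ B} {f₁' : A ⇒ A₁} {g₁ : X ⇒ Y₁} {g₁' : Y₁ ⇒ Y}
    {f₂ : A₂ ⇒ B} {f₂' : A ⇒ A₂} {g₂ : X ⇒ Y₂} {g₂' : Y₂ ⇒ Y}
    (p₁ : Lin₂ (Lbody f₁ g₁)) (q₁ : Lin₂ (Lbody f₁' g₁'))
    (p₂ : Lin₂ (Lbody f₂ g₂)) (q₂ : Lin₂ (Lbody f₂' g₂')) →
    f₁ ∘ f₁' ≈ f₂ ∘ f₂' → g₁' ∘ g₁ ≈ g₂' ∘ g₂ →
    Lmap f₁' g₁' q₁ ∘ Lmap f₁ g₁ p₁ ≈ Lmap f₂' g₂' q₂ ∘ Lmap f₂ g₂ p₂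
  Lmap-square {f₁ = f₁} {f₁'} {g₁} {g₁'} {f₂} {f₂'} {g₂} {g₂'} p₁ q₁ p₂ q₂ f-square g-square =
    𝓛-ext λ u v → begin
      ε ∘ ⟨ (Lmap f₁' g₁' q₁ ∘ Lmap f₁ g₁ p₁) ∘ u , v ⟩   ≈⟨ Lmap-∘-pt p₁ q₁ u v ⟩
      (g₁' ∘ g₁) ∘ (ε ∘ ⟨ u , (f₁ ∘ f₁') ∘ v ⟩)           ≈⟨ ∘-resp-≈ g-square (ε-cong ≈.refl (∘-resp-≈ˡ f-square)) ⟩
      (g₂' ∘ g₂) ∘ (ε ∘ ⟨ u , (f₂ ∘ f₂') ∘ v ⟩)           ≈⟨ Lmap-∘-pt p₂ q₂ u v ⟨
      ε ∘ ⟨ (Lmap f₂' g₂' q₂ ∘ Lmap f₂ g₂ p₂) ∘ u , v ⟩   ∎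

  module 𝓛-× (A B C : Obj) where
    p₀ : Lin₂ (Lbody (id {A}) (π₀ {B} {C}))
    p₀ = Lbody-Lin₂ Linear-id Linear-π₀

    p₁ : Lin₂ (Lbody (id {A}) (π₁ {B} {C}))
    p₁ = Lbody-Lin₂ Linear-id Linear-π₁

    unpair : 𝓛 A (B ×ₒ C) ⇒ 𝓛 A B ×ₒ 𝓛 A C
    unpair = ⟨ Lmap id π₀ p₀ , Lmap id π₁ p₁ ⟩

    pairBody : (𝓛 A B ×ₒ 𝓛 A C) ×ₒ A ⇒ B ×ₒ C
    pairBody = ⟨ ε ∘ (π₀ ⁂ id) , ε ∘ (π₁ ⁂ id) ⟩

    pairBody-Lin₂ : Lin₂ pairBody
    pairBody-Lin₂ = Lin₂-pair (Bilinear-⁂-Lin₂ ε-bilinear Linear-id) (Bilinear-⁂-Lin₂ ε-bilinear Linear-id)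

    pair : 𝓛 A B ×ₒ 𝓛 A C ⇒ 𝓛 A (B ×ₒ C)
    pair = λℓ pairBody pairBody-Lin₂

    pair-pt : ∀ (u : Γ ⇒ 𝓛 A B ×ₒ 𝓛 A C) (v : Γ ⇒ A) →
              ε ∘ ⟨ pair ∘ u , v ⟩ ≈ ⟨ ε ∘ ⟨ π₀ ∘ u , v ⟩ , ε ∘ ⟨ π₁ ∘ u , v ⟩ ⟩
    pair-pt u v = begin
      ε ∘ ⟨ pair ∘ u , v ⟩                                                  ≈⟨ λℓ-β-pt pairBody-Lin₂ u v ⟩
      pairBody ∘ ⟨ u , v ⟩                                                  ≈⟨ ⟨⟩∘ ⟩
      ⟨ (ε ∘ (π₀ ⁂ id)) ∘ ⟨ u , v ⟩ , (ε ∘ (π₁ ⁂ id)) ∘ ⟨ u , v ⟩ ⟩         ≈⟨ ⟨⟩-cong₂ ∘⁂∘⟨⟩ ∘⁂∘⟨⟩ ⟩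
      ⟨ ε ∘ ⟨ π₀ ∘ u , id ∘ v ⟩ , ε ∘ ⟨ π₁ ∘ u , id ∘ v ⟩ ⟩                 ≈⟨ ⟨⟩-cong₂ (ε-cong ≈.refl identityˡ)
                                                                                        (ε-cong ≈.refl identityˡ) ⟩
      ⟨ ε ∘ ⟨ π₀ ∘ u , v ⟩ , ε ∘ ⟨ π₁ ∘ u , v ⟩ ⟩                           ∎

    pair∘unpair : pair ∘ unpair ≈ id
    pair∘unpair = 𝓛-ext λ u v → begin
      ε ∘ ⟨ (pair ∘ unpair) ∘ u , v ⟩                                       ≈⟨ ε-cong assoc ≈.refl ⟩
      ε ∘ ⟨ pair ∘ (unpair ∘ u) , v ⟩                                       ≈⟨ pair-pt _ v ⟩
      ⟨ ε ∘ ⟨ π₀ ∘ (unpair ∘ u) , v ⟩ , ε ∘ ⟨ π₁ ∘ (unpair ∘ u) , v ⟩ ⟩     ≈⟨ ⟨⟩-cong₂ (ε-cong project₀-∘ ≈.refl)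
                                                                                        (ε-cong project₁-∘ ≈.refl) ⟩
      ⟨ ε ∘ ⟨ Lmap id π₀ p₀ ∘ u , v ⟩ , ε ∘ ⟨ Lmap id π₁ p₁ ∘ u , v ⟩ ⟩     ≈⟨ ⟨⟩-cong₂ (Lmap-pt p₀ u v) (Lmap-pt p₁ u v) ⟩
      ⟨ π₀ ∘ (ε ∘ ⟨ u , id ∘ v ⟩) , π₁ ∘ (ε ∘ ⟨ u , id ∘ v ⟩) ⟩             ≈⟨ η ⟩
      ε ∘ ⟨ u , id ∘ v ⟩                                                    ≈⟨ ε-cong (≈.sym identityˡ) identityˡ ⟩
      ε ∘ ⟨ id ∘ u , v ⟩                                                    ∎

    π₀∘unpair∘pair : π₀ ∘ (unpair ∘ pair) ≈ π₀ ∘ id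
    π₀∘unpair∘pair = ≈.trans project₀-∘ (≈.trans (𝓛-ext λ u v → begin
      ε ∘ ⟨ (Lmap id π₀ p₀ ∘ pair) ∘ u , v ⟩    ≈⟨ ε-cong assoc ≈.refl ⟩
      ε ∘ ⟨ Lmap id π₀ p₀ ∘ (pair ∘ u) , v ⟩    ≈⟨ Lmap-pt p₀ _ v ⟩
      π₀ ∘ (ε ∘ ⟨ pair ∘ u , id ∘ v ⟩)          ≈⟨ ∘-resp-≈ʳ (pair-pt u _) ⟩
      π₀ ∘ ⟨ ε ∘ ⟨ π₀ ∘ u , id ∘ v ⟩ , _ ⟩      ≈⟨ project₀ ⟩
      ε ∘ ⟨ π₀ ∘ u , id ∘ v ⟩                   ≈⟨ ε-cong ≈.refl identityˡ ⟩
      ε ∘ ⟨ π₀ ∘ u , v ⟩                        ∎) (≈.sym identityʳ))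

    π₁∘unpair∘pair : π₁ ∘ (unpair ∘ pair) ≈ π₁ ∘ id
    π₁∘unpair∘pair = ≈.trans project₁-∘ (≈.trans (𝓛-ext λ u v → begin
      ε ∘ ⟨ (Lmap id π₁ p₁ ∘ pair) ∘ u , v ⟩    ≈⟨ ε-cong assoc ≈.refl ⟩
      ε ∘ ⟨ Lmap id π₁ p₁ ∘ (pair ∘ u) , v ⟩    ≈⟨ Lmap-pt p₁ _ v ⟩
      π₁ ∘ (ε ∘ ⟨ pair ∘ u , id ∘ v ⟩)          ≈⟨ ∘-resp-≈ʳ (pair-pt u _) ⟩
      π₁ ∘ ⟨ _ , ε ∘ ⟨ π₁ ∘ u , id ∘ v ⟩ ⟩      ≈⟨ project₁ ⟩
      ε ∘ ⟨ π₁ ∘ u , id ∘ v ⟩                   ≈⟨ ε-cong ≈.refl identityˡ ⟩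
      ε ∘ ⟨ π₁ ∘ u , v ⟩                        ∎) (≈.sym identityʳ))

    iso : LinIso (𝓛 A (B ×ₒ C)) (𝓛 A B ×ₒ 𝓛 A C)
    iso = record
      { to       = unpair
      ; from     = pair
      ; to-lin   = Linear-pair (Lmap-Linear Linear-π₀ p₀) (Lmap-Linear Linear-π₁ p₁)
      ; from-lin = λℓ-Linear pairBody-Lin₂
                     (Lin₁-pair (Bilinear-⁂-Lin₁ ε-bilinear Linear-π₀) (Bilinear-⁂-Lin₁ ε-bilinear Linear-π₁))
      ; isoˡ     = pair∘unpair
      ; isoʳ     = ×-ext π₀∘unpair∘pair π₁∘unpair∘pair
      }

  𝓛-×-natural : ∀ {A A' B B' C C'} (a : A' ⇒ A) (b : B ⇒ B') (c : C ⇒ C')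
    (p : Lin₂ (Lbody a b)) (q : Lin₂ (Lbody a c)) (r : Lin₂ (Lbody a (b ⁂ c))) →
    (Lmap a b p ⁂ Lmap a c q) ∘ 𝓛-×.unpair A B C ≈ 𝓛-×.unpair A' B' C' ∘ Lmap a (b ⁂ c) r
  𝓛-×-natural {A} {A'} {B} {B'} {C} {C'} a b c p q r = ×-ext
    (begin
      π₀ ∘ ((Lmap a b p ⁂ Lmap a c q) ∘ unpair A B C)   ≈⟨ π₀-⁂-∘ ⟩
      Lmap a b p ∘ (π₀ ∘ unpair A B C)                  ≈⟨ ∘-resp-≈ʳ project₀ ⟩
      Lmap a b p ∘ Lmap id π₀ (p₀ A B C)                ≈⟨ Lmap-square _ _ _ _ id-a (≈.sym project₀) ⟩
      Lmap id π₀ (p₀ A' B' C') ∘ Lmap a (b ⁂ c) r       ≈⟨ project₀-∘ ⟨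
      π₀ ∘ (unpair A' B' C' ∘ Lmap a (b ⁂ c) r)         ∎)
    (begin
      π₁ ∘ ((Lmap a b p ⁂ Lmap a c q) ∘ unpair A B C)   ≈⟨ π₁-⁂-∘ ⟩
      Lmap a c q ∘ (π₁ ∘ unpair A B C)                  ≈⟨ ∘-resp-≈ʳ project₁ ⟩
      Lmap a c q ∘ Lmap id π₁ (p₁ A B C)                ≈⟨ Lmap-square _ _ _ _ id-a (≈.sym project₁) ⟩
      Lmap id π₁ (p₁ A' B' C') ∘ Lmap a (b ⁂ c) r       ≈⟨ project₁-∘ ⟨
      π₁ ∘ (unpair A' B' C' ∘ Lmap a (b ⁂ c) r)         ∎)
    where
    open 𝓛-× using (unpair; p₀; p₁)
    id-a : id ∘ a ≈ a ∘ id
    id-a = ≈.trans identityˡ (≈.sym identityʳ)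

  module 𝓛-+ (A B C : Obj) where
    copairBody : (𝓛 A C ×ₒ 𝓛 B C) ×ₒ (A ×ₒ B) ⇒ C
    copairBody = ε ∘ (π₀ ⁂ π₀) + ε ∘ (π₁ ⁂ π₁)

    copairBody-Lin₂ : Lin₂ copairBody
    copairBody-Lin₂ = Lin₂-+ (Bilinear-⁂-Lin₂ ε-bilinear Linear-π₀) (Bilinear-⁂-Lin₂ ε-bilinear Linear-π₁)

    copair : 𝓛 A C ×ₒ 𝓛 B C ⇒ 𝓛 (A ×ₒ B) C
    copair = λℓ copairBody copairBody-Lin₂

    copair-pt : ∀ (u : Γ ⇒ 𝓛 A C ×ₒ 𝓛 B C) (v : Γ ⇒ A ×ₒ B) →
                ε ∘ ⟨ copair ∘ u , v ⟩ ≈ ε ∘ ⟨ π₀ ∘ u , π₀ ∘ v ⟩ + ε ∘ ⟨ π₁ ∘ u , π₁ ∘ v ⟩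
    copair-pt u v = ≈.trans (λℓ-β-pt copairBody-Lin₂ u v) (≈.trans (+-∘ _ _ _) (+-resp-≈ ∘⁂∘⟨⟩ ∘⁂∘⟨⟩))

    ι₀ : A ⇒ A ×ₒ B
    ι₀ = ⟨ id , 0m ⟩

    ι₁ : B ⇒ A ×ₒ B
    ι₁ = ⟨ 0m , id ⟩

    q₀ : Lin₂ (Lbody ι₀ (id {C}))
    q₀ = Lbody-Lin₂ (Linear-pair Linear-id Linear-0) Linear-id

    q₁ : Lin₂ (Lbody ι₁ (id {C}))
    q₁ = Lbody-Lin₂ (Linear-pair Linear-0 Linear-id) Linear-id

    restrict : 𝓛 (A ×ₒ B) C ⇒ 𝓛 A C ×ₒ 𝓛 B C
    restrict = ⟨ Lmap ι₀ id q₀ , Lmap ι₁ id q₁ ⟩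

    ι₀∘π₀+ι₁∘π₁ : ∀ {v : Γ ⇒ A ×ₒ B} → ι₀ ∘ (π₀ ∘ v) + ι₁ ∘ (π₁ ∘ v) ≈ v
    ι₀∘π₀+ι₁∘π₁ {v = v} = begin
      ι₀ ∘ (π₀ ∘ v) + ι₁ ∘ (π₁ ∘ v)                                   ≈⟨ +-resp-≈ ⟨⟩∘ ⟨⟩∘ ⟩
      ⟨ id ∘ (π₀ ∘ v) , 0m ∘ (π₀ ∘ v) ⟩ + ⟨ 0m ∘ (π₁ ∘ v) , id ∘ (π₁ ∘ v) ⟩ ≈⟨ ⟨⟩+⟨⟩ ⟩
      ⟨ id ∘ (π₀ ∘ v) + 0m ∘ (π₁ ∘ v) , 0m ∘ (π₀ ∘ v) + id ∘ (π₁ ∘ v) ⟩    ≈⟨ ⟨⟩-cong₂ first second ⟩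
      ⟨ π₀ ∘ v , π₁ ∘ v ⟩                                             ≈⟨ η ⟩
      v                                                               ∎
      where
      first : id ∘ (π₀ ∘ v) + 0m ∘ (π₁ ∘ v) ≈ π₀ ∘ v
      first = ≈.trans (+-resp-≈ identityˡ (0-∘ _)) (+-identityʳ _)
      second : 0m ∘ (π₀ ∘ v) + id ∘ (π₁ ∘ v) ≈ π₁ ∘ v
      second = ≈.trans (+-resp-≈ (0-∘ _) identityˡ) (+-identityˡ _)

    copair∘restrict : copair ∘ restrict ≈ id
    copair∘restrict = 𝓛-ext λ u v → begin
      ε ∘ ⟨ (copair ∘ restrict) ∘ u , v ⟩                              ≈⟨ ε-cong assoc ≈.refl ⟩
      ε ∘ ⟨ copair ∘ (restrict ∘ u) , v ⟩                              ≈⟨ copair-pt _ v ⟩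
      ε ∘ ⟨ π₀ ∘ (restrict ∘ u) , π₀ ∘ v ⟩
        + ε ∘ ⟨ π₁ ∘ (restrict ∘ u) , π₁ ∘ v ⟩                         ≈⟨ +-resp-≈ (ε-cong project₀-∘ ≈.refl)
                                                                                   (ε-cong project₁-∘ ≈.refl) ⟩
      ε ∘ ⟨ Lmap ι₀ id q₀ ∘ u , π₀ ∘ v ⟩
        + ε ∘ ⟨ Lmap ι₁ id q₁ ∘ u , π₁ ∘ v ⟩                           ≈⟨ +-resp-≈ (Lmap-pt q₀ u _) (Lmap-pt q₁ u _) ⟩
      id ∘ (ε ∘ ⟨ u , ι₀ ∘ (π₀ ∘ v) ⟩) + id ∘ (ε ∘ ⟨ u , ι₁ ∘ (π₁ ∘ v) ⟩) ≈⟨ +-resp-≈ identityˡ identityˡ ⟩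
      ε ∘ ⟨ u , ι₀ ∘ (π₀ ∘ v) ⟩ + ε ∘ ⟨ u , ι₁ ∘ (π₁ ∘ v) ⟩              ≈⟨ Lin₂-+ʳ (proj₂ ε-bilinear) u _ _ ⟨
      ε ∘ ⟨ u , ι₀ ∘ (π₀ ∘ v) + ι₁ ∘ (π₁ ∘ v) ⟩                        ≈⟨ ε-cong (≈.sym identityˡ) ι₀∘π₀+ι₁∘π₁ ⟩
      ε ∘ ⟨ id ∘ u , v ⟩                                               ∎

    π₀∘restrict∘copair : π₀ ∘ (restrict ∘ copair) ≈ π₀ ∘ id
    π₀∘restrict∘copair = ≈.trans project₀-∘ (≈.trans (𝓛-ext λ u v → begin
      ε ∘ ⟨ (Lmap ι₀ id q₀ ∘ copair) ∘ u , v ⟩                         ≈⟨ ε-cong assoc ≈.refl ⟩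
      ε ∘ ⟨ Lmap ι₀ id q₀ ∘ (copair ∘ u) , v ⟩                         ≈⟨ ≈.trans (Lmap-pt q₀ _ v) identityˡ ⟩
      ε ∘ ⟨ copair ∘ u , ι₀ ∘ v ⟩                                      ≈⟨ copair-pt u _ ⟩
      ε ∘ ⟨ π₀ ∘ u , π₀ ∘ (ι₀ ∘ v) ⟩ + ε ∘ ⟨ π₁ ∘ u , π₁ ∘ (ι₀ ∘ v) ⟩   ≈⟨ +-resp-≈ (ε-cong ≈.refl (≈.trans project₀-∘ identityˡ))
                                                                                   (ε-cong ≈.refl (≈.trans project₁-∘ (0-∘ v))) ⟩
      ε ∘ ⟨ π₀ ∘ u , v ⟩ + ε ∘ ⟨ π₁ ∘ u , 0m ⟩                          ≈⟨ ≈.trans (+-resp-≈ ≈.refl ε-0ʳ) (+-identityʳ _) ⟩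
      ε ∘ ⟨ π₀ ∘ u , v ⟩                                               ∎) (≈.sym identityʳ))

    π₁∘restrict∘copair : π₁ ∘ (restrict ∘ copair) ≈ π₁ ∘ id
    π₁∘restrict∘copair = ≈.trans project₁-∘ (≈.trans (𝓛-ext λ u v → begin
      ε ∘ ⟨ (Lmap ι₁ id q₁ ∘ copair) ∘ u , v ⟩                         ≈⟨ ε-cong assoc ≈.refl ⟩
      ε ∘ ⟨ Lmap ι₁ id q₁ ∘ (copair ∘ u) , v ⟩                         ≈⟨ ≈.trans (Lmap-pt q₁ _ v) identityˡ ⟩
      ε ∘ ⟨ copair ∘ u , ι₁ ∘ v ⟩                                      ≈⟨ copair-pt u _ ⟩
      ε ∘ ⟨ π₀ ∘ u , π₀ ∘ (ι₁ ∘ v) ⟩ + ε ∘ ⟨ π₁ ∘ u , π₁ ∘ (ι₁ ∘ v) ⟩   ≈⟨ +-resp-≈ (ε-cong ≈.refl (≈.trans project₀-∘ (0-∘ v)))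
                                                                                   (ε-cong ≈.refl (≈.trans project₁-∘ identityˡ)) ⟩
      ε ∘ ⟨ π₀ ∘ u , 0m ⟩ + ε ∘ ⟨ π₁ ∘ u , v ⟩                          ≈⟨ ≈.trans (+-resp-≈ ε-0ʳ ≈.refl) (+-identityˡ _) ⟩
      ε ∘ ⟨ π₁ ∘ u , v ⟩                                               ∎) (≈.sym identityʳ))

    iso : LinIso (𝓛 A C ×ₒ 𝓛 B C) (𝓛 (A ×ₒ B) C)
    iso = record
      { to       = copair
      ; from     = restrict
      ; to-lin   = λℓ-Linear copairBody-Lin₂
                     (Lin₁-+ (Bilinear-⁂-Lin₁ ε-bilinear Linear-π₀) (Bilinear-⁂-Lin₁ ε-bilinear Linear-π₁))
      ; from-lin = Linear-pair (Lmap-Linear Linear-id q₀) (Lmap-Linear Linear-id q₁)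
      ; isoˡ     = ×-ext π₀∘restrict∘copair π₁∘restrict∘copair
      ; isoʳ     = copair∘restrict
      }

  𝓛-+-natural : ∀ {A A' B B' C C'} (a : A' ⇒ A) (b : B' ⇒ B) (c : C ⇒ C') → Linear c →
    (p : Lin₂ (Lbody a c)) (q : Lin₂ (Lbody b c)) (r : Lin₂ (Lbody (a ⁂ b) c)) →
    Lmap (a ⁂ b) c r ∘ 𝓛-+.copair A B C ≈ 𝓛-+.copair A' B' C' ∘ (Lmap a c p ⁂ Lmap b c q)
  𝓛-+-natural {A} {A'} {B} {B'} {C} {C'} a b c lc p q r = 𝓛-ext λ u v → begin
    ε ∘ ⟨ (Lmap (a ⁂ b) c r ∘ copair A B C) ∘ u , v ⟩               ≈⟨ ε-cong assoc ≈.refl ⟩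
    ε ∘ ⟨ Lmap (a ⁂ b) c r ∘ (copair A B C ∘ u) , v ⟩               ≈⟨ Lmap-pt r _ v ⟩
    c ∘ (ε ∘ ⟨ copair A B C ∘ u , (a ⁂ b) ∘ v ⟩)                    ≈⟨ ∘-resp-≈ʳ (copair-pt A B C u _) ⟩
    c ∘ (ε ∘ ⟨ π₀ ∘ u , π₀ ∘ ((a ⁂ b) ∘ v) ⟩
          + ε ∘ ⟨ π₁ ∘ u , π₁ ∘ ((a ⁂ b) ∘ v) ⟩)                    ≈⟨ ∘-resp-≈ʳ (+-resp-≈ (ε-cong ≈.refl π₀-⁂-∘) (ε-cong ≈.refl π₁-⁂-∘)) ⟩
    c ∘ (ε ∘ ⟨ π₀ ∘ u , a ∘ (π₀ ∘ v) ⟩ + ε ∘ ⟨ π₁ ∘ u , b ∘ (π₁ ∘ v) ⟩) ≈⟨ Linear-+ lc _ _ ⟩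
    c ∘ (ε ∘ ⟨ π₀ ∘ u , a ∘ (π₀ ∘ v) ⟩)
      + c ∘ (ε ∘ ⟨ π₁ ∘ u , b ∘ (π₁ ∘ v) ⟩)                         ≈⟨ +-resp-≈ (Lmap-pt p _ _) (Lmap-pt q _ _) ⟨
    ε ∘ ⟨ Lmap a c p ∘ (π₀ ∘ u) , π₀ ∘ v ⟩
      + ε ∘ ⟨ Lmap b c q ∘ (π₁ ∘ u) , π₁ ∘ v ⟩                      ≈⟨ +-resp-≈ (ε-cong π₀-⁂-∘ ≈.refl)
                                                                                (ε-cong π₁-⁂-∘ ≈.refl) ⟨
    ε ∘ ⟨ π₀ ∘ ((Lmap a c p ⁂ Lmap b c q) ∘ u) , π₀ ∘ v ⟩
      + ε ∘ ⟨ π₁ ∘ ((Lmap a c p ⁂ Lmap b c q) ∘ u) , π₁ ∘ v ⟩       ≈⟨ copair-pt A' B' C' _ v ⟨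
    ε ∘ ⟨ copair A' B' C' ∘ ((Lmap a c p ⁂ Lmap b c q) ∘ u) , v ⟩   ≈⟨ ε-cong assoc ≈.refl ⟨
    ε ∘ ⟨ (copair A' B' C' ∘ (Lmap a c p ⁂ Lmap b c q)) ∘ u , v ⟩   ∎
    where
    open 𝓛-+ using (copair; copair-pt)

  IsSubterminal : Obj → Set (o ⊔ ℓ ⊔ e)
  IsSubterminal X = ∀ {Γ} (f g : Γ ⇒ X) → f ≈ g

  subterminal-LinIso : ∀ {X} → IsSubterminal X → LinIso X ⊤ₒ
  subterminal-LinIso sub = record
    { to = ! ; from = 0m ; to-lin = λ a b → ⊤-≈ _ _ ; from-lin = Linear-0
    ; isoˡ = sub _ _ ; isoʳ = ⊤-≈ _ _ }

  LinIso-sym : LinIso A B → LinIso B A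
  LinIso-sym i = record
    { to = from ; from = to ; to-lin = from-lin ; from-lin = to-lin ; isoˡ = isoʳ ; isoʳ = isoˡ }
    where open LinIso i

  𝓛-⊤-subterminal : IsSubterminal (𝓛 A ⊤ₒ)
  𝓛-⊤-subterminal h h' = 𝓛-ext λ u v → ⊤-≈ _ _

  -- The only generalized element of ⊤ is 0, at which ε vanishes.
  𝓛⊤-subterminal : IsSubterminal (𝓛 ⊤ₒ A)
  𝓛⊤-subterminal h h' = 𝓛-ext λ u v → begin
    ε ∘ ⟨ h ∘ u , v ⟩     ≈⟨ ε-cong ≈.refl (⊤-≈ v 0m) ⟩
    ε ∘ ⟨ h ∘ u , 0m ⟩    ≈⟨ ε-0ʳ ⟩
    0m                    ≈⟨ ε-0ʳ ⟨
    ε ∘ ⟨ h' ∘ u , 0m ⟩   ≈⟨ ε-cong ≈.refl (⊤-≈ v 0m) ⟨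
    ε ∘ ⟨ h' ∘ u , v ⟩    ∎

  module 𝓛-swap (A B C : Obj) where
    ε-ε-0ˡ : ∀ {x : Γ ⇒ 𝓛 A (𝓛 B C)} {a : Γ ⇒ A} {b : Γ ⇒ B} → x ≈ 0m → ε ∘ ⟨ ε ∘ ⟨ x , a ⟩ , b ⟩ ≈ 0m
    ε-ε-0ˡ x≈0 = ≈.trans (ε-cong (≈.trans (ε-cong x≈0 ≈.refl) ε-0ˡ) ≈.refl) ε-0ˡ

    swapBody : (𝓛 A (𝓛 B C) ×ₒ B) ×ₒ A ⇒ C
    swapBody = ε ∘ ⟨ ε ∘ (π₀ ⁂ id) , π₁ ∘ π₀ ⟩

    inner-pt : ∀ {P : Γ ⇒ 𝓛 A (𝓛 B C) ×ₒ B} {a : Γ ⇒ A} → (ε ∘ (π₀ ⁂ id)) ∘ ⟨ P , a ⟩ ≈ ε ∘ ⟨ π₀ ∘ P , a ⟩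
    inner-pt = ≈.trans ∘⁂∘⟨⟩ (ε-cong ≈.refl identityˡ)

    π₁∘π₀-pt : ∀ {P : Γ ⇒ 𝓛 A (𝓛 B C) ×ₒ B} {a : Γ ⇒ A} → (π₁ ∘ π₀) ∘ ⟨ P , a ⟩ ≈ π₁ ∘ P
    π₁∘π₀-pt = ≈.trans assoc (∘-resp-≈ʳ project₀)

    swapBody-pt : ∀ {P : Γ ⇒ 𝓛 A (𝓛 B C) ×ₒ B} {a : Γ ⇒ A} →
                  swapBody ∘ ⟨ P , a ⟩ ≈ ε ∘ ⟨ ε ∘ ⟨ π₀ ∘ P , a ⟩ , π₁ ∘ P ⟩
    swapBody-pt = ≈.trans ∘⟨⟩∘ (ε-cong inner-pt π₁∘π₀-pt)

    swapBody-D : ∀ {P P' : Γ ⇒ 𝓛 A (𝓛 B C) ×ₒ B} {a a' : Γ ⇒ A} →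
      D swapBody ∘ ⟨ ⟨ P , a ⟩ , ⟨ P' , a' ⟩ ⟩ ≈
        ε ∘ ⟨ ε ∘ ⟨ π₀ ∘ P' , a ⟩ + ε ∘ ⟨ π₀ ∘ P , a' ⟩ , π₁ ∘ P ⟩ + ε ∘ ⟨ ε ∘ ⟨ π₀ ∘ P , a ⟩ , π₁ ∘ P' ⟩
    swapBody-D = ≈.trans (Bilinear-Leibniz ε-bilinear)
      (+-resp-≈ (ε-cong D-inner π₁∘π₀-pt)
                (ε-cong inner-pt (≈.trans (Linear-∘ Linear-π₀ Linear-π₁ _ _) π₁∘π₀-pt)))
      where
      D-inner : ∀ {P P' : Γ ⇒ 𝓛 A (𝓛 B C) ×ₒ B} {a a' : Γ ⇒ A} →
                D (ε ∘ (π₀ ⁂ id)) ∘ ⟨ ⟨ P , a ⟩ , ⟨ P' , a' ⟩ ⟩ ≈ ε ∘ ⟨ π₀ ∘ P' , a ⟩ + ε ∘ ⟨ π₀ ∘ P , a' ⟩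
      D-inner = ≈.trans (Bilinear-⁂-D ε-bilinear)
        (+-resp-≈ (ε-cong D-π₀-pt identityˡ) (ε-cong ≈.refl (≈.trans (Linear-id _ _) identityˡ)))

    swapBody-Lin₂ : Lin₂ swapBody
    swapBody-Lin₂ P a a' = begin
      D swapBody ∘ ⟨ ⟨ P , a ⟩ , ⟨ 0m , a' ⟩ ⟩                       ≈⟨ swapBody-D ⟩
      ε ∘ ⟨ ε ∘ ⟨ π₀ ∘ 0m , a ⟩ + ε ∘ ⟨ π₀ ∘ P , a' ⟩ , π₁ ∘ P ⟩
        + ε ∘ ⟨ ε ∘ ⟨ π₀ ∘ P , a ⟩ , π₁ ∘ 0m ⟩                       ≈⟨ +-resp-≈ (ε-cong drop ≈.refl)
                                                                                 (≈.trans (ε-cong ≈.refl π₁-0) ε-0ʳ) ⟩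
      ε ∘ ⟨ ε ∘ ⟨ π₀ ∘ P , a' ⟩ , π₁ ∘ P ⟩ + 0m                      ≈⟨ +-identityʳ _ ⟩
      ε ∘ ⟨ ε ∘ ⟨ π₀ ∘ P , a' ⟩ , π₁ ∘ P ⟩                           ≈⟨ swapBody-pt ⟨
      swapBody ∘ ⟨ P , a' ⟩                                          ∎
      where
      drop : ε ∘ ⟨ π₀ ∘ 0m , a ⟩ + ε ∘ ⟨ π₀ ∘ P , a' ⟩ ≈ ε ∘ ⟨ π₀ ∘ P , a' ⟩
      drop = ≈.trans (+-resp-≈ (≈.trans (ε-cong π₀-0 ≈.refl) ε-0ˡ) ≈.refl) (+-identityˡ _)

    swapBody-D-along : ∀ {P P' : Γ ⇒ 𝓛 A (𝓛 B C) ×ₒ B} {a : Γ ⇒ A} →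
      D swapBody ∘ ⟨ ⟨ P , a ⟩ , ⟨ P' , 0m ⟩ ⟩ ≈
        ε ∘ ⟨ ε ∘ ⟨ π₀ ∘ P' , a ⟩ , π₁ ∘ P ⟩ + ε ∘ ⟨ ε ∘ ⟨ π₀ ∘ P , a ⟩ , π₁ ∘ P' ⟩
    swapBody-D-along = ≈.trans swapBody-D
      (+-resp-≈ (ε-cong (≈.trans (+-resp-≈ ≈.refl ε-0ʳ) (+-identityʳ _)) ≈.refl) ≈.refl)

    swapBody-pt-∘ : ∀ {Δ} {s : Γ ⇒ 𝓛 A (𝓛 B C)} {b : Γ ⇒ B} {u : Δ ⇒ Γ} {v : Δ ⇒ A} →
                    swapBody ∘ ⟨ ⟨ s , b ⟩ ∘ u , v ⟩ ≈ ε ∘ ⟨ ε ∘ ⟨ s ∘ u , v ⟩ , b ∘ u ⟩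
    swapBody-pt-∘ = ≈.trans swapBody-pt (ε-cong (ε-cong project₀-∘ ≈.refl) project₁-∘)

    swapCurry : 𝓛 A (𝓛 B C) ×ₒ B ⇒ 𝓛 A C
    swapCurry = λℓ swapBody swapBody-Lin₂

    swapCurry-Lin₂ : Lin₂ swapCurry
    swapCurry-Lin₂ s b d = D-λℓ-≈ swapBody-Lin₂ λ u v → begin
      D swapBody ∘ ⟨ ⟨ ⟨ s , b ⟩ ∘ u , v ⟩ , ⟨ ⟨ 0m , d ⟩ ∘ u , 0m ⟩ ⟩  ≈⟨ swapBody-D-along ⟩
      ε ∘ ⟨ ε ∘ ⟨ π₀ ∘ (⟨ 0m , d ⟩ ∘ u) , v ⟩ , π₁ ∘ (⟨ s , b ⟩ ∘ u) ⟩
        + ε ∘ ⟨ ε ∘ ⟨ π₀ ∘ (⟨ s , b ⟩ ∘ u) , v ⟩ , π₁ ∘ (⟨ 0m , d ⟩ ∘ u) ⟩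
                                                 ≈⟨ +-resp-≈ (ε-ε-0ˡ (≈.trans project₀-∘ (0-∘ u)))
                                                             (ε-cong (ε-cong project₀-∘ ≈.refl) project₁-∘) ⟩
      0m + ε ∘ ⟨ ε ∘ ⟨ s ∘ u , v ⟩ , d ∘ u ⟩      ≈⟨ +-identityˡ _ ⟩
      ε ∘ ⟨ ε ∘ ⟨ s ∘ u , v ⟩ , d ∘ u ⟩           ≈⟨ swapBody-pt-∘ ⟨
      swapBody ∘ ⟨ ⟨ s , d ⟩ ∘ u , v ⟩            ∎

    swapCurry-Lin₁ : Lin₁ swapCurry
    swapCurry-Lin₁ s c b = D-λℓ-≈ swapBody-Lin₂ λ u v → begin
      D swapBody ∘ ⟨ ⟨ ⟨ s , b ⟩ ∘ u , v ⟩ , ⟨ ⟨ c , 0m ⟩ ∘ u , 0m ⟩ ⟩  ≈⟨ swapBody-D-along ⟩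
      ε ∘ ⟨ ε ∘ ⟨ π₀ ∘ (⟨ c , 0m ⟩ ∘ u) , v ⟩ , π₁ ∘ (⟨ s , b ⟩ ∘ u) ⟩
        + ε ∘ ⟨ ε ∘ ⟨ π₀ ∘ (⟨ s , b ⟩ ∘ u) , v ⟩ , π₁ ∘ (⟨ c , 0m ⟩ ∘ u) ⟩
                                                 ≈⟨ +-resp-≈ (ε-cong (ε-cong project₀-∘ ≈.refl) project₁-∘)
                                                             (≈.trans (ε-cong ≈.refl (≈.trans project₁-∘ (0-∘ u))) ε-0ʳ) ⟩
      ε ∘ ⟨ ε ∘ ⟨ c ∘ u , v ⟩ , b ∘ u ⟩ + 0m      ≈⟨ +-identityʳ _ ⟩
      ε ∘ ⟨ ε ∘ ⟨ c ∘ u , v ⟩ , b ∘ u ⟩           ≈⟨ swapBody-pt-∘ ⟨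
      swapBody ∘ ⟨ ⟨ c , b ⟩ ∘ u , v ⟩            ∎

    swap : 𝓛 A (𝓛 B C) ⇒ 𝓛 B (𝓛 A C)
    swap = λℓ swapCurry swapCurry-Lin₂

    swap-Linear : Linear swap
    swap-Linear = λℓ-Linear swapCurry-Lin₂ swapCurry-Lin₁

    swap-pt : ∀ (x : Γ ⇒ 𝓛 A (𝓛 B C)) (y : Γ ⇒ B) (z : Γ ⇒ A) →
              ε ∘ ⟨ ε ∘ ⟨ swap ∘ x , y ⟩ , z ⟩ ≈ ε ∘ ⟨ ε ∘ ⟨ x , z ⟩ , y ⟩
    swap-pt x y z = begin
      ε ∘ ⟨ ε ∘ ⟨ swap ∘ x , y ⟩ , z ⟩                       ≈⟨ ε-cong (λℓ-β-pt swapCurry-Lin₂ x y) ≈.refl ⟩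
      ε ∘ ⟨ swapCurry ∘ ⟨ x , y ⟩ , z ⟩                      ≈⟨ λℓ-β-pt swapBody-Lin₂ _ z ⟩
      swapBody ∘ ⟨ ⟨ x , y ⟩ , z ⟩                           ≈⟨ swapBody-pt ⟩
      ε ∘ ⟨ ε ∘ ⟨ π₀ ∘ ⟨ x , y ⟩ , z ⟩ , π₁ ∘ ⟨ x , y ⟩ ⟩    ≈⟨ ε-cong (ε-cong project₀ ≈.refl) project₁ ⟩
      ε ∘ ⟨ ε ∘ ⟨ x , z ⟩ , y ⟩                              ∎

  swap∘swap : ∀ A B C → 𝓛-swap.swap B A C ∘ 𝓛-swap.swap A B C ≈ id
  swap∘swap A B C = 𝓛-ext₂ λ u a b → begin
    ε ∘ ⟨ ε ∘ ⟨ (swap B A C ∘ swap A B C) ∘ u , a ⟩ , b ⟩   ≈⟨ ε-cong (ε-cong assoc ≈.refl) ≈.refl ⟩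
    ε ∘ ⟨ ε ∘ ⟨ swap B A C ∘ (swap A B C ∘ u) , a ⟩ , b ⟩   ≈⟨ swap-pt B A C _ a b ⟩
    ε ∘ ⟨ ε ∘ ⟨ swap A B C ∘ u , b ⟩ , a ⟩                  ≈⟨ swap-pt A B C u b a ⟩
    ε ∘ ⟨ ε ∘ ⟨ u , a ⟩ , b ⟩                               ≈⟨ ε-cong (ε-cong identityˡ ≈.refl) ≈.refl ⟨
    ε ∘ ⟨ ε ∘ ⟨ id ∘ u , a ⟩ , b ⟩                          ∎
    where open 𝓛-swap using (swap; swap-pt)

  swap-LinIso : ∀ A B C → LinIso (𝓛 A (𝓛 B C)) (𝓛 B (𝓛 A C))
  swap-LinIso A B C = record
    { to = swap A B C ; from = swap B A C
    ; to-lin = swap-Linear A B C ; from-lin = swap-Linear B A C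
    ; isoˡ = swap∘swap A B C ; isoʳ = swap∘swap B A C }
    where open 𝓛-swap using (swap; swap-Linear)

  swap-natural : ∀ {A A' B B' C C'} (a : A' ⇒ A) (b : B' ⇒ B) (c : C ⇒ C')
    (p : Lin₂ (Lbody a c)) (q : Lin₂ (Lbody b (Lmap a c p)))
    (r : Lin₂ (Lbody b c)) (s : Lin₂ (Lbody a (Lmap b c r))) →
    Lmap b (Lmap a c p) q ∘ 𝓛-swap.swap A B C ≈ 𝓛-swap.swap A' B' C' ∘ Lmap a (Lmap b c r) s
  swap-natural {A} {A'} {B} {B'} {C} {C'} a b c p q r s = 𝓛-ext₂ λ u y x → begin
    ε ∘ ⟨ ε ∘ ⟨ (Lmap b (Lmap a c p) q ∘ swap A B C) ∘ u , y ⟩ , x ⟩   ≈⟨ ε-cong (ε-cong assoc ≈.refl) ≈.refl ⟩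
    ε ∘ ⟨ ε ∘ ⟨ Lmap b (Lmap a c p) q ∘ (swap A B C ∘ u) , y ⟩ , x ⟩   ≈⟨ ε-cong (Lmap-pt q _ y) ≈.refl ⟩
    ε ∘ ⟨ Lmap a c p ∘ (ε ∘ ⟨ swap A B C ∘ u , b ∘ y ⟩) , x ⟩          ≈⟨ Lmap-pt p _ x ⟩
    c ∘ (ε ∘ ⟨ ε ∘ ⟨ swap A B C ∘ u , b ∘ y ⟩ , a ∘ x ⟩)               ≈⟨ ∘-resp-≈ʳ (swap-pt A B C u _ _) ⟩
    c ∘ (ε ∘ ⟨ ε ∘ ⟨ u , a ∘ x ⟩ , b ∘ y ⟩)                            ≈⟨ Lmap-pt r _ y ⟨
    ε ∘ ⟨ Lmap b c r ∘ (ε ∘ ⟨ u , a ∘ x ⟩) , y ⟩                       ≈⟨ ε-cong (Lmap-pt s u x) ≈.refl ⟨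
    ε ∘ ⟨ ε ∘ ⟨ Lmap a (Lmap b c r) s ∘ u , x ⟩ , y ⟩                  ≈⟨ swap-pt A' B' C' _ y x ⟨
    ε ∘ ⟨ ε ∘ ⟨ swap A' B' C' ∘ (Lmap a (Lmap b c r) s ∘ u) , y ⟩ , x ⟩ ≈⟨ ε-cong (ε-cong assoc ≈.refl) ≈.refl ⟨
    ε ∘ ⟨ ε ∘ ⟨ (swap A' B' C' ∘ Lmap a (Lmap b c r) s) ∘ u , y ⟩ , x ⟩ ∎
    where open 𝓛-swap using (swap; swap-pt)

mainTheorem1 : ∀ {o ℓ e} (𝕏 : CDC o ℓ e) (LC : LinearlyClosed 𝕏) →
    let open Claims 𝕏 LC in
    Claim1 × Claim2 × Claim3 × Claim4
mainTheorem1 𝕏 LC =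
    ( (λ f g pf pg → Lin₂-+ pf pg , λℓ-+ pf pg _)
    , (Lin₂-0 , λℓ-0 _) )
  , (λ f pf → ∂₀-Lin₂ pf , D-λℓ pf _)
  , ( (λ f g lf lg → Lbody-Lin₂ lf lg)
    , (λ f g lf lg p → Lmap-Linear lg p)
    , (λ f₁ f₂ g₁ g₂ _ _ f₁≈f₂ g₁≈g₂ → Lmap-cong f₁≈f₂ g₁≈g₂)
    , Lmap-id
    , (λ f f' g g' _ _ _ _ → Lmap-∘) )
  , ( (𝓛-×.iso , λ a b c _ _ _ → 𝓛-×-natural a b c)
    , (𝓛-+.iso , λ a b c _ _ lc → 𝓛-+-natural a b c lc)
    , ((λ A → subterminal-LinIso 𝓛-⊤-subterminal) , λ a _ p → ⊤-≈ _ _)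
    , ((λ A → LinIso-sym (subterminal-LinIso 𝓛⊤-subterminal)) , λ g _ p → 𝓛⊤-subterminal _ _)
    , (swap-LinIso , λ a b c _ _ _ → swap-natural a b c) )
  where
  open CDCProperties 𝕏
  open LinearlyClosedProperties LC
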